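{- Let $H=H_{a,b,c,n+m,(u_i)_{i=1}^m,(v_j)_{j=1}^n}$ and $H'=H_{a',b',c',n+m,(u'_i)_{i=1}^m,(v'_j)_{j=1}^n}$ be dented hexagons with $u_i\le u'_i$ for all $i$ and $v_j\le v'_j$ for all $j$. If $H$ has a lozenge tiling, then so does $H'$.
   Context: Work on the triangular lattice with horizontal lattice lines. A lozenge is the union of two unit triangles sharing an edge; a lozenge tiling of a region is a covering of it by non-overlapping lozenges contained in it. For nonnegative integers $a,b,c,t$, $H_{a,b,c,t}$ is the lattice hexagon with side lengths, clockwise starting from the northern side, $a$ (north), $b+t$ (northeast), $c$ (southeast), $a+t$ (south), $b$ (southwest), $c+t$ (northwest). A unit triangle is "along" a side if it shares an edge with that side; the triangles along the northeast (resp. northwest) side are indexed $1,\dots,b+t$ (resp. $1,\dots,c+t$) from the north. Given $1\le u_1<\dots<u_m\le b+t$ and $1\le v_1<\dots<v_n\le c+t$ with $a>0$ or $u_1>1$ or $v_1>1$, the dented hexagon $H_{a,b,c,t,\vec u,\vec v}$ is obtained from $H_{a,b,c,t}$ by removing the $u_i$-th triangle along the northeast side for each $i$ and the $v_j$-th triangle along the northwest side for each $j$. -}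

module Defs where

open import Data.Nat using (ℕ; zero; suc; _+_; _∸_; _≤_; _<_)
open import Data.Fin as Fin using (Fin)
open import Data.Product using (Σ; _×_; _,_; proj₁; proj₂)
open import Data.Sum using (_⊎_)
open import Data.List using (List; []; _∷_; concatMap)
open import Data.List.Membership.Propositional using (_∈_)
open import Data.List.Relation.Unary.Unique.Propositional using (Unique)
open import Relation.Nullary using (¬_)
open import Relation.Binary.PropositionalEquality using (_≡_)

-- Lattice coordinates: the point (x , y) is x·e₁ + y·e₂ with e₁ = (1,0),
-- e₂ = (1/2, √3/2), so horizontal lattice lines are y = const.
-- ▲ i j : up-pointing unit triangle with vertices (i,j), (i+1,j), (i,j+1)
-- ▼ i j : down-pointing unit triangle with vertices (i+1,j), (i,j+1), (i+1,j+1)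
data Tri : Set where
  ▲ : ℕ → ℕ → Tri
  ▼ : ℕ → ℕ → Tri

-- Two unit triangles sharing an edge (every such pair is of one of these forms).
data Adjacent : Tri → Tri → Set where
  diag  : ∀ i j → Adjacent (▲ i j) (▼ i j)            -- edge (i+1,j)–(i,j+1)
  vert  : ∀ i j → Adjacent (▲ (suc i) j) (▼ i j)      -- edge (i+1,j)–(i+1,j+1)
  horiz : ∀ i j → Adjacent (▲ i (suc j)) (▼ i j)      -- edge (i,j+1)–(i+1,j+1) (horizontal)

Lozenge : Set
Lozenge = Σ (Tri × Tri) (λ p → Adjacent (proj₁ p) (proj₂ p))

cells : List Lozenge → List Tri
cells = concatMap (λ { ((s , t) , _) → s ∷ t ∷ [] })

Region : Set₁
Region = Tri → Set

Tiling : Region → Set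
Tiling R = Σ (List Lozenge) λ L →
  ((τ : Tri) → (R τ → τ ∈ cells L) × (τ ∈ cells L → R τ)) × Unique (cells L)

Tileable : Region → Set
Tileable R = Tiling R

-- With the west end of the south side placed at
-- (b , 0) its vertices are (b,0), (0,b), (0,b+c+t), (a,b+c+t), (a+b+t,c),
-- (a+b+t,0), i.e. it is  0 ≤ x ≤ a+b+t, 0 ≤ y ≤ b+c+t, b ≤ x+y ≤ a+b+c+t.
-- Sides (clockwise from north): a, b+t, c, a+t, b, c+t.
-- A unit triangle belongs to it iff its three vertices do (convexity).
InHex : (a b c t : ℕ) → Tri → Set
InHex a b c t (▲ i j) =
  (j + 1 ≤ b + c + t) × (i + 1 ≤ a + b + t) × (b ≤ i + j) × (i + j + 1 ≤ a + b + c + t)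
InHex a b c t (▼ i j) =
  (j + 1 ≤ b + c + t) × (i + 1 ≤ a + b + t) × (b ≤ i + j + 1) × (i + j + 2 ≤ a + b + c + t)

-- The k-th unit triangle (k = 1,…,b+t, counted from the north) along the
-- northeast side (the line x+y = a+b+c+t): it is the up-triangle whose
-- edge runs from (a+k-1, b+c+t-k+1) to (a+k, b+c+t-k).
neTri : (a b c t k : ℕ) → Tri
neTri a b c t k = ▲ (a + k ∸ 1) (b + c + t ∸ k)

-- The k-th unit triangle (k = 1,…,c+t, counted from the north) along the
-- northwest side (the line x = 0): edge from (0, b+c+t-k) to (0, b+c+t-k+1).
nwTri : (a b c t k : ℕ) → Tri
nwTri a b c t k = ▲ 0 (b + c + t ∸ k)

Dented : (a b c t : ℕ) {m n : ℕ} → (Fin m → ℕ) → (Fin n → ℕ) → Region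
Dented a b c t u v τ =
  InHex a b c t τ
  × (∀ i → ¬ (τ ≡ neTri a b c t (u i)))
  × (∀ j → ¬ (τ ≡ nwTri a b c t (v j)))

StrictlyIncreasing : {m : ℕ} → (Fin m → ℕ) → Set
StrictlyIncreasing {m} u = ∀ (i j : Fin m) → i Fin.< j → u i < u j

-- Standing hypotheses for H_{a,b,c,t,u,v}:
-- 1 ≤ u₁ < … < u_m ≤ b+t, 1 ≤ v₁ < … < v_n ≤ c+t, and (a > 0 or u₁ > 1 or v₁ > 1)
-- (an empty index sequence imposes no dent at position 1).
ValidDents : (a b c t : ℕ) {m n : ℕ} → (Fin m → ℕ) → (Fin n → ℕ) → Set
ValidDents a b c t u v =
  StrictlyIncreasing u × StrictlyIncreasing v
  × (∀ i → 1 ≤ u i × u i ≤ b + t)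
  × (∀ j → 1 ≤ v j × v j ≤ c + t)
  × (0 < a ⊎ (∀ i → 1 < u i) ⊎ (∀ j → 1 < v j))

module Submission where

-- Index the dents from 0. Everything goes through the criterion
--   (i + 1) + (j + 1) ≤ max (u i) (v j)   for all i, j,
-- which is plainly preserved when u and v increase; it is necessary for a tiling of H and
-- sufficient for a tiling of H′.
--
-- Necessity: if k = max (u i) (v j) exceeds b + t or c + t the criterion holds since
-- (i + 1) + (j + 1) ≤ m + n = t. Otherwise the top k rows of the hexagon form a trapezoid with
-- k more up- than down-triangles. A tiling pairs each of its down-triangles with a neighbour
-- that lies in these rows and is not a dent, while the first i + 1 northeast and j + 1 northwest
-- dents are further up-triangles of these rows; hence (i + 1) + (j + 1) ≤ k.
--
-- Sufficiency: the tiling pairs every up-triangle with an adjacent down-triangle. In row y an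
-- up-triangle is paired within its row exactly when it lies in a block of consecutive positions
-- at the left boundary, of length a plus the number of northwest dents at or above row y, or on
-- the path of a northeast dent at or above row y; otherwise it is paired with the down-triangle
-- below it. From one row to the next the block and each path move by at most one step, the
-- paths stay to the right of the block, and the criterion keeps them inside the hexagon.

open import Defs
open import Data.Nat using (ℕ; zero; suc; _+_; _∸_; _≤_; _<_; _≤?_; _<?_; z≤n; s≤s; _⊔_)
open import Data.Nat.Properties
open import Data.Nat.Tactic.RingSolver using (solve-∀)
open import Data.Fin as Fin using (Fin; toℕ)
import Data.Fin.Properties as Finₚ
open import Data.Product using (Σ; ∃₂; _×_; _,_; proj₁; proj₂)
open import Data.Sum using (_⊎_; inj₁; inj₂)
open import Data.List using (List; []; _∷_; _++_; map; length; lookup; upTo; allFin; cartesianProduct)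
open import Data.List.Properties using (length-++; length-map; length-upTo; length-tabulate)
open import Data.List.Membership.Propositional using (_∈_)
open import Data.List.Membership.Propositional.Properties
  using (∈-lookup; ∈-++⁻; ∈-++⁺ˡ; ∈-++⁺ʳ; ∈-map⁻; ∈-map⁺; ∈-upTo⁺; ∈-upTo⁻; ∈-cartesianProduct⁺)
open import Data.List.Relation.Binary.Subset.Propositional using (_⊆_)
open import Data.List.Relation.Unary.Any using (here; there; index)
open import Data.List.Relation.Unary.Any.Properties using (lookup-index)
open import Data.List.Relation.Unary.All as All using ([]; _∷_)
open import Data.List.Relation.Unary.All.Properties as All using ()
open import Data.List.Relation.Unary.AllPairs using ([]; _∷_)
open import Data.List.Relation.Unary.Unique.Propositional using (Unique)
open import Data.List.Relation.Unary.Unique.Propositional.Properties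
  using (map⁺; ++⁺; upTo⁺; allFin⁺; cartesianProduct⁺)
open import Data.Empty using (⊥; ⊥-elim)
open import Function using (_∘_)
open import Relation.Nullary using (¬_; Dec; yes; no)
open import Relation.Nullary.Decidable using (map′; ¬?; _×-dec_; toSum)
open import Relation.Unary using (Decidable)
open import Relation.Binary using (DecidableEquality; tri<; tri≈; tri>)
open import Relation.Binary.PropositionalEquality
  using (_≡_; _≢_; refl; sym; trans; cong; cong₂; subst; module ≡-Reasoning)

▲-injective : ∀ {i j i′ j′} → ▲ i j ≡ ▲ i′ j′ → i ≡ i′ × j ≡ j′
▲-injective refl = refl , refl

▼-injective : ∀ {i j i′ j′} → ▼ i j ≡ ▼ i′ j′ → i ≡ i′ × j ≡ j′
▼-injective refl = refl , refl

_≟ᵀ_ : DecidableEquality Tri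
▲ i j ≟ᵀ ▲ i′ j′ = map′ (λ { (refl , refl) → refl }) ▲-injective (i ≟ i′ ×-dec j ≟ j′)
▼ i j ≟ᵀ ▼ i′ j′ = map′ (λ { (refl , refl) → refl }) ▼-injective (i ≟ i′ ×-dec j ≟ j′)
▲ _ _ ≟ᵀ ▼ _ _ = no (λ ())
▼ _ _ ≟ᵀ ▲ _ _ = no (λ ())

Adjacent⇒≢▲ : ∀ {s t} → Adjacent s t → ∀ i j → t ≢ ▲ i j
Adjacent⇒≢▲ (diag _ _) _ _ ()
Adjacent⇒≢▲ (vert _ _) _ _ ()
Adjacent⇒≢▲ (horiz _ _) _ _ ()

Adjacent-irreflexive : ∀ {s} → ¬ Adjacent s s
Adjacent-irreflexive ()

Unique⇒lookup-injective : ∀ {A : Set} {xs : List A} → Unique xs →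
  ∀ {i j} → lookup xs i ≡ lookup xs j → i ≡ j
Unique⇒lookup-injective (_ ∷ _) {Fin.zero} {Fin.zero} _ = refl
Unique⇒lookup-injective (x∉xs ∷ _) {Fin.zero} {Fin.suc j} e = ⊥-elim (All.lookup x∉xs (∈-lookup j) e)
Unique⇒lookup-injective (x∉xs ∷ _) {Fin.suc i} {Fin.zero} e = ⊥-elim (All.lookup x∉xs (∈-lookup i) (sym e))
Unique⇒lookup-injective (_ ∷ u) {Fin.suc i} {Fin.suc j} e = cong Fin.suc (Unique⇒lookup-injective u e)

Unique∧⊆⇒length≤ : ∀ {A : Set} {xs ys : List A} → Unique xs → xs ⊆ ys → length xs ≤ length ys
Unique∧⊆⇒length≤ {xs = xs} {ys} u xs⊆ys = Finₚ.injective⇒≤ {f = position} position-injective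
  where
    position : Fin (length xs) → Fin (length ys)
    position k = index (xs⊆ys (∈-lookup k))
    position-injective : ∀ {k l} → position k ≡ position l → k ≡ l
    position-injective {k} {l} e = Unique⇒lookup-injective u (begin
      lookup xs k                   ≡⟨ lookup-index (xs⊆ys (∈-lookup k)) ⟩
      lookup ys (position k)        ≡⟨ cong (lookup ys) e ⟩
      lookup ys (position l)        ≡⟨ sym (lookup-index (xs⊆ys (∈-lookup l))) ⟩
      lookup xs l                   ∎)
      where open ≡-Reasoning

Unique-map⁺ : ∀ {A B : Set} {f : A → B} {xs : List A} →
  (∀ {x y} → x ∈ xs → y ∈ xs → f x ≡ f y → x ≡ y) → Unique xs → Unique (map f xs)
Unique-map⁺ _ [] = []
Unique-map⁺ injective (x∉xs ∷ u) =
  All.map⁺ (All.tabulate λ y∈ e → All.lookup x∉xs y∈ (injective (here refl) (there y∈) e))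
  ∷ Unique-map⁺ (λ x∈ y∈ → injective (there x∈) (there y∈)) u

record UpDownMatching (R : Region) : Set where
  field
    partner            : ℕ → ℕ → Tri
    partner-adjacent   : ∀ {x y} → R (▲ x y) → Adjacent (▲ x y) (partner x y)
    partner-∈          : ∀ {x y} → R (▲ x y) → R (partner x y)
    partner-injective  : ∀ {x y x′ y′} → R (▲ x y) → R (▲ x′ y′) →
                         partner x y ≡ partner x′ y′ → (x , y) ≡ (x′ , y′)
    partner-surjective : ∀ {x y} → R (▼ x y) → ∃₂ λ i j → R (▲ i j) × partner i j ≡ ▼ x y

module _ {R : Region} (R? : Decidable R) (M : UpDownMatching R)
  (B : ℕ) (bounded : ∀ {x y} → R (▲ x y) → x < B × y < B) where
  open UpDownMatching M

  private
    lozenges : List (ℕ × ℕ) → List Lozenge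
    lozenges [] = []
    lozenges ((x , y) ∷ ks) with R? (▲ x y)
    ... | yes r = ((▲ x y , partner x y) , partner-adjacent r) ∷ lozenges ks
    ... | no _  = lozenges ks

    FromKey : List (ℕ × ℕ) → Tri → Set
    FromKey ks τ = ∃₂ λ x y → (x , y) ∈ ks × R (▲ x y) × (τ ≡ ▲ x y ⊎ τ ≡ partner x y)

    FromKey-there : ∀ {k ks τ} → FromKey ks τ → FromKey (k ∷ ks) τ
    FromKey-there (x , y , k∈ , r , e) = x , y , there k∈ , r , e

    cells-lozenges⁻ : ∀ ks {τ} → τ ∈ cells (lozenges ks) → FromKey ks τ
    cells-lozenges⁻ ((x , y) ∷ ks) τ∈ with R? (▲ x y)
    ... | no _ = FromKey-there (cells-lozenges⁻ ks τ∈)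
    ... | yes r with τ∈
    ...   | here e          = x , y , here refl , r , inj₁ e
    ...   | there (here e)  = x , y , here refl , r , inj₂ e
    ...   | there (there p) = FromKey-there (cells-lozenges⁻ ks p)

    ▲∈cells : ∀ ks {x y} → (x , y) ∈ ks → R (▲ x y) → ▲ x y ∈ cells (lozenges ks)
    ▲∈cells ((x′ , y′) ∷ ks) k∈ r with R? (▲ x′ y′) | k∈
    ... | yes _ | here refl = here refl
    ... | yes _ | there k∈′ = there (there (▲∈cells ks k∈′ r))
    ... | no ¬r | here refl = ⊥-elim (¬r r)
    ... | no _  | there k∈′ = ▲∈cells ks k∈′ r

    partner∈cells : ∀ ks {x y} → (x , y) ∈ ks → R (▲ x y) → partner x y ∈ cells (lozenges ks)
    partner∈cells ((x′ , y′) ∷ ks) k∈ r with R? (▲ x′ y′) | k∈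
    ... | yes _ | here refl = there (here refl)
    ... | yes _ | there k∈′ = there (there (partner∈cells ks k∈′ r))
    ... | no ¬r | here refl = ⊥-elim (¬r r)
    ... | no _  | there k∈′ = partner∈cells ks k∈′ r

    partner≢▲ : ∀ {x y} → R (▲ x y) → ∀ i j → partner x y ≢ ▲ i j
    partner≢▲ r = Adjacent⇒≢▲ (partner-adjacent r)

    unique-cells : ∀ {ks} → Unique ks → Unique (cells (lozenges ks))
    unique-cells {[]} [] = []
    unique-cells {(x , y) ∷ ks} (k∉ks ∷ uks) with R? (▲ x y)
    ... | no _  = unique-cells uks
    ... | yes r = (▲≢partner ∷ All.tabulate ▲∉) ∷ All.tabulate partner∉ ∷ unique-cells uks
      where
        ▲≢partner : ▲ x y ≢ partner x y
        ▲≢partner e = partner≢▲ r x y (sym e)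
        ▲∉ : ∀ {τ} → τ ∈ cells (lozenges ks) → ▲ x y ≢ τ
        ▲∉ τ∈ refl with cells-lozenges⁻ ks τ∈
        ... | _ , _ , k∈ , _ , inj₁ refl = All.lookup k∉ks k∈ refl
        ... | x′ , y′ , _ , r′ , inj₂ e = partner≢▲ r′ x y (sym e)
        partner∉ : ∀ {τ} → τ ∈ cells (lozenges ks) → partner x y ≢ τ
        partner∉ τ∈ e with cells-lozenges⁻ ks τ∈
        ... | x′ , y′ , _ , _ , inj₁ refl = partner≢▲ r x′ y′ e
        ... | x′ , y′ , k∈ , r′ , inj₂ refl = All.lookup k∉ks k∈ (partner-injective r r′ e)

  matching⇒tiling : Tiling R
  matching⇒tiling =
    lozenges keys , (λ τ → covers τ , inside τ) , unique-cells (cartesianProduct⁺ (upTo⁺ B) (upTo⁺ B))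
    where
      keys : List (ℕ × ℕ)
      keys = cartesianProduct (upTo B) (upTo B)
      key∈ : ∀ {x y} → R (▲ x y) → (x , y) ∈ keys
      key∈ r = ∈-cartesianProduct⁺ (∈-upTo⁺ (proj₁ (bounded r))) (∈-upTo⁺ (proj₂ (bounded r)))
      covers : ∀ τ → R τ → τ ∈ cells (lozenges keys)
      covers (▲ x y) r = ▲∈cells keys (key∈ r) r
      covers (▼ x y) r with partner-surjective r
      ... | i , j , r′ , e = subst (_∈ cells (lozenges keys)) e (partner∈cells keys (key∈ r′) r′)
      inside : ∀ τ → τ ∈ cells (lozenges keys) → R τ
      inside τ τ∈ with cells-lozenges⁻ keys τ∈
      ... | _ , _ , _ , r , inj₁ refl = r
      ... | _ , _ , _ , r , inj₂ refl = partner-∈ r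

Neighbours : Tri → Tri → Set
Neighbours σ τ = Adjacent σ τ ⊎ Adjacent τ σ

partnerIn : List Lozenge → Tri → Tri
partnerIn [] τ = τ
partnerIn (((s , t) , _) ∷ L) τ with τ ≟ᵀ s
... | yes _ = t
... | no _ with τ ≟ᵀ t
...   | yes _ = s
...   | no _  = partnerIn L τ

module _ {s t : Tri} {a : Adjacent s t} {L : List Lozenge} where

  partnerIn-up : partnerIn (((s , t) , a) ∷ L) s ≡ t
  partnerIn-up with s ≟ᵀ s
  ... | yes _  = refl
  ... | no s≢s = ⊥-elim (s≢s refl)

  partnerIn-down : partnerIn (((s , t) , a) ∷ L) t ≡ s
  partnerIn-down with t ≟ᵀ s
  ... | yes refl = ⊥-elim (Adjacent-irreflexive a)
  ... | no _ with t ≟ᵀ t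
  ...   | yes _  = refl
  ...   | no t≢t = ⊥-elim (t≢t refl)

  partnerIn-there : ∀ {τ} → τ ≢ s → τ ≢ t → partnerIn (((s , t) , a) ∷ L) τ ≡ partnerIn L τ
  partnerIn-there {τ} τ≢s τ≢t with τ ≟ᵀ s
  ... | yes τ≡s = ⊥-elim (τ≢s τ≡s)
  ... | no _ with τ ≟ᵀ t
  ...   | yes τ≡t = ⊥-elim (τ≢t τ≡t)
  ...   | no _    = refl

partnerIn-∈ : ∀ L {τ} → τ ∈ cells L → partnerIn L τ ∈ cells L × Neighbours τ (partnerIn L τ)
partnerIn-∈ (((s , t) , a) ∷ L) {τ} τ∈ with τ ≟ᵀ s
... | yes refl = there (here refl) , inj₁ a
... | no τ≢s with τ ≟ᵀ t
...   | yes refl = here refl , inj₂ a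
...   | no τ≢t with τ∈
...     | here e           = ⊥-elim (τ≢s e)
...     | there (here e)   = ⊥-elim (τ≢t e)
...     | there (there τ∈L) with partnerIn-∈ L τ∈L
...       | p∈ , n = there (there p∈) , n

partnerIn-involutive : ∀ L {τ} → Unique (cells L) → τ ∈ cells L → partnerIn L (partnerIn L τ) ≡ τ
partnerIn-involutive (((s , t) , a) ∷ L) {τ} ((_ ∷ s∉) ∷ t∉ ∷ u) τ∈ with τ ≟ᵀ s
... | yes refl = partnerIn-down {a = a} {L}
... | no τ≢s with τ ≟ᵀ t
...   | yes refl = partnerIn-up {a = a} {L}
...   | no τ≢t with τ∈
...     | here e           = ⊥-elim (τ≢s e)
...     | there (here e)   = ⊥-elim (τ≢t e)
...     | there (there τ∈L) =
          trans (partnerIn-there {a = a} {L} (λ e → All.lookup s∉ p∈ (sym e)) (λ e → All.lookup t∉ p∈ (sym e)))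
                (partnerIn-involutive L u τ∈L)
  where p∈ = proj₁ (partnerIn-∈ L τ∈L)

-- The tiling partners of the triangles ds are distinct triangles of us, none of them a hole.
tiling-count : ∀ {R : Region} → Tiling R → {ds es us : List Tri} → Unique ds → Unique es →
  (∀ {d} → d ∈ ds → R d) →
  (∀ {d σ} → d ∈ ds → R σ → Neighbours d σ → σ ∈ us) →
  (∀ {e} → e ∈ es → e ∈ us × ¬ R e) →
  length ds + length es ≤ length us
tiling-count {R} (L , covering , unique) {ds} {es} {us} uds ues ds⊆R neighbours⊆us holes = begin
  length ds + length es           ≡⟨ cong (_+ length es) (sym (length-map p ds)) ⟩
  length (map p ds) + length es   ≡⟨ sym (length-++ (map p ds)) ⟩
  length (map p ds ++ es)         ≤⟨ Unique∧⊆⇒length≤ unique-image image⊆us ⟩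
  length us                       ∎
  where
    open ≤-Reasoning
    p : Tri → Tri
    p = partnerIn L
    ∈L : ∀ {d} → d ∈ ds → d ∈ cells L
    ∈L d∈ = proj₁ (covering _) (ds⊆R d∈)
    partner∈R : ∀ {d} → d ∈ ds → R (p d)
    partner∈R d∈ = proj₂ (covering _) (proj₁ (partnerIn-∈ L (∈L d∈)))
    p-injective : ∀ {d d′} → d ∈ ds → d′ ∈ ds → p d ≡ p d′ → d ≡ d′
    p-injective d∈ d′∈ e =
      trans (sym (partnerIn-involutive L unique (∈L d∈)))
            (trans (cong p e) (partnerIn-involutive L unique (∈L d′∈)))
    unique-image : Unique (map p ds ++ es)
    unique-image = ++⁺ (Unique-map⁺ p-injective uds) ues λ (p∈ , e∈) →
      let (d , d∈ , e) = ∈-map⁻ p p∈ in proj₂ (holes e∈) (subst R (sym e) (partner∈R d∈))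
    image⊆us : map p ds ++ es ⊆ us
    image⊆us τ∈ with ∈-++⁻ (map p ds) τ∈
    ... | inj₂ e∈ = proj₁ (holes e∈)
    ... | inj₁ p∈ with ∈-map⁻ p p∈
    ...   | d , d∈ , refl = neighbours⊆us d∈ (partner∈R d∈) (proj₂ (partnerIn-∈ L (∈L d∈)))

module _ {k : ℕ} (w : Fin (suc k) → ℕ) (w↑ : StrictlyIncreasing w) where

  strictlyIncreasing-tail : StrictlyIncreasing (w ∘ Fin.suc)
  strictlyIncreasing-tail i j i<j = w↑ (Fin.suc i) (Fin.suc j) (s≤s i<j)

  head<tail : ∀ j → w Fin.zero < w (Fin.suc j)
  head<tail j = w↑ Fin.zero (Fin.suc j) (s≤s z≤n)

index+head≤ : ∀ {k} (w : Fin (suc k) → ℕ) → StrictlyIncreasing w → ∀ i → toℕ i + w Fin.zero ≤ w i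
index+head≤ w w↑ Fin.zero = ≤-refl
index+head≤ {suc k} w w↑ (Fin.suc i) = begin
  suc (toℕ i + w Fin.zero)         ≡⟨ +-suc (toℕ i) (w Fin.zero) ⟨
  toℕ i + suc (w Fin.zero)         ≤⟨ +-monoʳ-≤ (toℕ i) (head<tail w w↑ Fin.zero) ⟩
  toℕ i + w (Fin.suc Fin.zero)     ≤⟨ index+head≤ (w ∘ Fin.suc) (strictlyIncreasing-tail w w↑) i ⟩
  w (Fin.suc i)                    ∎
  where open ≤-Reasoning

index<positive : ∀ {k} (w : Fin k → ℕ) → StrictlyIncreasing w → (∀ i → 1 ≤ w i) → ∀ i → suc (toℕ i) ≤ w i
index<positive {suc k} w w↑ w≥1 i = begin
  suc (toℕ i)           ≡⟨ +-comm 1 (toℕ i) ⟩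
  toℕ i + 1             ≤⟨ +-monoʳ-≤ (toℕ i) (w≥1 Fin.zero) ⟩
  toℕ i + w Fin.zero    ≤⟨ index+head≤ w w↑ i ⟩
  w i                   ∎
  where open ≤-Reasoning

+remaining≤bound : ∀ {k} (w : Fin k → ℕ) → StrictlyIncreasing w → (M : ℕ) → (∀ i → w i ≤ M) →
                   ∀ i → w i + k ≤ M + suc (toℕ i)
+remaining≤bound {suc zero} w w↑ M w≤M Fin.zero = begin
  w Fin.zero + 1   ≡⟨ +-comm (w Fin.zero) 1 ⟩
  suc (w Fin.zero) ≤⟨ s≤s (w≤M Fin.zero) ⟩
  suc M            ≡⟨ +-comm 1 M ⟩
  M + 1            ∎
  where open ≤-Reasoning
+remaining≤bound {suc (suc k)} w w↑ M w≤M Fin.zero = begin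
  w Fin.zero + suc (suc k)         ≡⟨ +-suc (w Fin.zero) (suc k) ⟩
  suc (w Fin.zero) + suc k         ≤⟨ +-monoˡ-≤ (suc k) (head<tail w w↑ Fin.zero) ⟩
  w (Fin.suc Fin.zero) + suc k     ≤⟨ +remaining≤bound (w ∘ Fin.suc) (strictlyIncreasing-tail w w↑) M
                                        (w≤M ∘ Fin.suc) Fin.zero ⟩
  M + 1                            ∎
  where open ≤-Reasoning
+remaining≤bound {suc k} w w↑ M w≤M (Fin.suc i) = begin
  w (Fin.suc i) + suc k          ≡⟨ +-suc (w (Fin.suc i)) k ⟩
  suc (w (Fin.suc i) + k)        ≤⟨ s≤s (+remaining≤bound (w ∘ Fin.suc) (strictlyIncreasing-tail w w↑) M
                                             (w≤M ∘ Fin.suc) i) ⟩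
  suc (M + suc (toℕ i))          ≡⟨ +-suc M (suc (toℕ i)) ⟨
  M + suc (suc (toℕ i))          ∎
  where open ≤-Reasoning

strictlyIncreasing-injective : ∀ {k} (w : Fin k → ℕ) → StrictlyIncreasing w → ∀ i j → w i ≡ w j → i ≡ j
strictlyIncreasing-injective w w↑ i j e with Finₚ.<-cmp i j
... | tri< i<j _ _ = ⊥-elim (<-irrefl e (w↑ i j i<j))
... | tri≈ _ i≡j _ = i≡j
... | tri> _ _ j<i = ⊥-elim (<-irrefl (sym e) (w↑ j i j<i))

strictlyIncreasing-monotone : ∀ {k} (w : Fin k → ℕ) → StrictlyIncreasing w → ∀ i j → toℕ i ≤ toℕ j → w i ≤ w j
strictlyIncreasing-monotone w w↑ i j i≤j with m≤n⇒m<n∨m≡n i≤j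
... | inj₁ i<j = <⇒≤ (w↑ i j i<j)
... | inj₂ i≡j = ≤-reflexive (cong w (Finₚ.toℕ-injective i≡j))

module Counting (Y : ℕ) where

  count : ∀ {k} → (Fin k → ℕ) → ℕ → ℕ
  count {zero} w y = 0
  count {suc k} w y with w Fin.zero + y ≤? Y
  ... | yes _ = suc (count (w ∘ Fin.suc) y)
  ... | no _  = count (w ∘ Fin.suc) y

  count≤ : ∀ {k} (w : Fin k → ℕ) y → count w y ≤ k
  count≤ {zero} w y = z≤n
  count≤ {suc k} w y with w Fin.zero + y ≤? Y
  ... | yes _ = s≤s (count≤ (w ∘ Fin.suc) y)
  ... | no _  = m≤n⇒m≤1+n (count≤ (w ∘ Fin.suc) y)

  count-all : ∀ {k} (w : Fin k → ℕ) y → (∀ j → w j + y ≤ Y) → count w y ≡ k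
  count-all {zero} w y all = refl
  count-all {suc k} w y all with w Fin.zero + y ≤? Y
  ... | yes _ = cong suc (count-all (w ∘ Fin.suc) y (all ∘ Fin.suc))
  ... | no ¬p = ⊥-elim (¬p (all Fin.zero))

  count-none : ∀ {k} (w : Fin k → ℕ) y → (∀ j → ¬ (w j + y ≤ Y)) → count w y ≡ 0
  count-none {zero} w y none = refl
  count-none {suc k} w y none with w Fin.zero + y ≤? Y
  ... | yes p = ⊥-elim (none Fin.zero p)
  ... | no _  = count-none (w ∘ Fin.suc) y (none ∘ Fin.suc)

  count≡0⊎last : ∀ {k} (w : Fin k → ℕ) → StrictlyIncreasing w → ∀ y →
                 count w y ≡ 0 ⊎ Σ (Fin k) λ q → count w y ≡ suc (toℕ q) × w q + y ≤ Y
  count≡0⊎last {zero} w w↑ y = inj₁ refl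
  count≡0⊎last {suc k} w w↑ y with w Fin.zero + y ≤? Y
  ... | no ¬p = inj₁ (count-none (w ∘ Fin.suc) y λ j p →
                  ¬p (≤-trans (+-monoˡ-≤ y (<⇒≤ (head<tail w w↑ j))) p))
  ... | yes p with count≡0⊎last (w ∘ Fin.suc) (strictlyIncreasing-tail w w↑) y
  ...   | inj₁ e           = inj₂ (Fin.zero , cong suc e , p)
  ...   | inj₂ (q , e , p′) = inj₂ (Fin.suc q , cong suc e , p′)

  count-step : ∀ {k} (w : Fin k → ℕ) y → (∀ j → w j + y ≢ Y) → count w y ≡ count w (suc y)
  count-step {zero} w y _ = refl
  count-step {suc k} w y miss with w Fin.zero + y ≤? Y | w Fin.zero + suc y ≤? Y
  ... | yes _ | yes _  = cong suc (count-step (w ∘ Fin.suc) y (miss ∘ Fin.suc))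
  ... | no _  | no _   = count-step (w ∘ Fin.suc) y (miss ∘ Fin.suc)
  ... | yes p | no ¬p′ = ⊥-elim (¬p′ (≤-trans (≤-reflexive (+-suc (w Fin.zero) y)) (≤∧≢⇒< p (miss Fin.zero))))
  ... | no ¬p | yes p′ = ⊥-elim (¬p (≤-trans (n≤1+n _) (≤-trans (≤-reflexive (sym (+-suc (w Fin.zero) y))) p′)))

  count-step-hit : ∀ {k} (w : Fin k → ℕ) → StrictlyIncreasing w → ∀ y →
                   (Σ (Fin k) λ j → w j + y ≡ Y) → count w y ≡ suc (count w (suc y))
  count-step-hit {suc k} w w↑ y (Fin.zero , e) with w Fin.zero + y ≤? Y | w Fin.zero + suc y ≤? Y
  ... | _     | yes p′ = ⊥-elim (<-irrefl e (≤-trans (≤-reflexive (sym (+-suc (w Fin.zero) y))) p′))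
  ... | no ¬p | no _   = ⊥-elim (¬p (≤-reflexive e))
  ... | yes _ | no _   = cong suc (trans (count-none (w ∘ Fin.suc) y (beyond y ≤-refl))
                                         (sym (count-none (w ∘ Fin.suc) (suc y) (beyond (suc y) (n≤1+n y)))))
    where
      beyond : ∀ y′ → y ≤ y′ → ∀ j → ¬ (w (Fin.suc j) + y′ ≤ Y)
      beyond y′ y≤y′ j p = <-irrefl e (≤-trans (+-mono-≤ (head<tail w w↑ j) y≤y′) p)
  count-step-hit {suc k} w w↑ y (Fin.suc j , e) with w Fin.zero + y ≤? Y | w Fin.zero + suc y ≤? Y
  ... | yes _ | yes _ = cong suc (count-step-hit (w ∘ Fin.suc) (strictlyIncreasing-tail w w↑) y (j , e))
  ... | _     | no ¬p′ = ⊥-elim (¬p′ (≤-trans (≤-reflexive (+-suc (w Fin.zero) y))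
                            (≤-trans (+-monoˡ-≤ y (head<tail w w↑ j)) (≤-reflexive e))))
  ... | no ¬p | yes p′ = ⊥-elim (¬p (≤-trans (n≤1+n _) (≤-trans (≤-reflexive (sym (+-suc (w Fin.zero) y))) p′)))

Criterion : ∀ {m n} → (Fin m → ℕ) → (Fin n → ℕ) → Set
Criterion u v = ∀ i j → suc (toℕ i) + suc (toℕ j) ≤ u i ⊔ v j

module Hexagon (a b c t : ℕ) where

  Y : ℕ
  Y = b + c + t

  a+Y : a + b + c + t ≡ a + Y
  a+Y = trans (+-assoc (a + b) c t) (trans (+-assoc a b (c + t)) (cong (a +_) (sym (+-assoc b c t))))

  ≤b+t⇒≤Y : ∀ {k} → k ≤ b + t → k ≤ Y
  ≤b+t⇒≤Y k≤ = ≤-trans k≤ (≤-trans (+-monoʳ-≤ b (m≤n+m t c)) (≤-reflexive (sym (+-assoc b c t))))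

  ≤c+t⇒≤Y : ∀ {k} → k ≤ c + t → k ≤ Y
  ≤c+t⇒≤Y k≤ = ≤-trans k≤ (≤-trans (m≤n+m (c + t) b) (≤-reflexive (sym (+-assoc b c t))))

criterion-mono : ∀ {m n} {u u′ : Fin m → ℕ} {v v′ : Fin n → ℕ} →
  (∀ i → u i ≤ u′ i) → (∀ j → v j ≤ v′ j) → Criterion u v → Criterion u′ v′
criterion-mono u≤u′ v≤v′ holds i j = ≤-trans (holds i j) (⊔-mono-≤ (u≤u′ i) (v≤v′ j))

InHex? : ∀ a b c t → Decidable (InHex a b c t)
InHex? a b c t (▲ i j) =
  (j + 1 ≤? b + c + t) ×-dec (i + 1 ≤? a + b + t) ×-dec (b ≤? i + j) ×-dec (i + j + 1 ≤? a + b + c + t)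
InHex? a b c t (▼ i j) =
  (j + 1 ≤? b + c + t) ×-dec (i + 1 ≤? a + b + t) ×-dec (b ≤? i + j + 1) ×-dec (i + j + 2 ≤? a + b + c + t)

Dented? : ∀ a b c t {m n} (u : Fin m → ℕ) (v : Fin n → ℕ) → Decidable (Dented a b c t u v)
Dented? a b c t u v τ =
  InHex? a b c t τ ×-dec Finₚ.all? (λ i → ¬? (τ ≟ᵀ neTri a b c t (u i)))
                   ×-dec Finₚ.all? (λ j → ¬? (τ ≟ᵀ nwTri a b c t (v j)))

module Necessity {a b c m n : ℕ} {u : Fin m → ℕ} {v : Fin n → ℕ}
  (valid : ValidDents a b c (n + m) u v) (T : Tiling (Dented a b c (n + m) u v)) where

  t : ℕ
  t = n + m
  open Hexagon a b c t

  R : Region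
  R = Dented a b c t u v

  u↑ : StrictlyIncreasing u
  u↑ = proj₁ valid
  v↑ : StrictlyIncreasing v
  v↑ = proj₁ (proj₂ valid)
  u-range : ∀ i → 1 ≤ u i × u i ≤ b + t
  u-range = proj₁ (proj₂ (proj₂ valid))
  v-range : ∀ j → 1 ≤ v j × v j ≤ c + t
  v-range = proj₁ (proj₂ (proj₂ (proj₂ valid)))

  -- Rows are counted from the top: row s is the line y = Y ∸ suc s.
  row▲ : ℕ → List Tri
  row▲ s = map (λ x → ▲ x (Y ∸ suc s)) (upTo (a + suc s))

  row▼ : ℕ → List Tri
  row▼ s = map (λ x → ▼ x (Y ∸ suc s)) (upTo (a + s))

  top▲ : ℕ → List Tri
  top▲ zero    = []
  top▲ (suc s) = row▲ s ++ top▲ s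

  top▼ : ℕ → List Tri
  top▼ zero    = []
  top▼ (suc s) = row▼ s ++ top▼ s

  length-top▲ : ∀ k → length (top▲ k) ≡ length (top▼ k) + k
  length-top▲ zero    = refl
  length-top▲ (suc s) = begin
    length (row▲ s ++ top▲ s)                 ≡⟨ length-++ (row▲ s) ⟩
    length (row▲ s) + length (top▲ s)         ≡⟨ cong₂ _+_ (length-row▲) (length-top▲ s) ⟩
    a + suc s + (length (top▼ s) + s)         ≡⟨ shuffle a s (length (top▼ s)) ⟩
    a + s + length (top▼ s) + suc s           ≡⟨ cong (_+ suc s) (cong (_+ length (top▼ s)) length-row▼) ⟨
    length (row▼ s) + length (top▼ s) + suc s ≡⟨ cong (_+ suc s) (length-++ (row▼ s)) ⟨
    length (row▼ s ++ top▼ s) + suc s         ∎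
    where
      open ≡-Reasoning
      length-row▲ : length (row▲ s) ≡ a + suc s
      length-row▲ = trans (length-map _ (upTo (a + suc s))) (length-upTo (a + suc s))
      length-row▼ : length (row▼ s) ≡ a + s
      length-row▼ = trans (length-map _ (upTo (a + s))) (length-upTo (a + s))
      shuffle : ∀ a s d → a + suc s + (d + s) ≡ a + s + d + suc s
      shuffle = solve-∀

  top▼⁻ : ∀ k {τ} → τ ∈ top▼ k → Σ ℕ λ x → Σ ℕ λ s → s < k × x < a + s × τ ≡ ▼ x (Y ∸ suc s)
  top▼⁻ (suc k) τ∈ with ∈-++⁻ (row▼ k) τ∈
  ... | inj₁ τ∈row with ∈-map⁻ (λ x → ▼ x (Y ∸ suc k)) τ∈row
  ...   | x , x∈ , e = x , k , ≤-refl , ∈-upTo⁻ x∈ , e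
  top▼⁻ (suc k) τ∈ | inj₂ τ∈top with top▼⁻ k τ∈top
  ... | x , s , s<k , x< , e = x , s , m≤n⇒m≤1+n s<k , x< , e

  top▲⁺ : ∀ k {s x} → s < k → x < a + suc s → ▲ x (Y ∸ suc s) ∈ top▲ k
  top▲⁺ (suc k) {s} s<k x< with m≤n⇒m<n∨m≡n (≤-pred s<k)
  ... | inj₁ s<k′ = ∈-++⁺ʳ (row▲ k) (top▲⁺ k s<k′ x<)
  ... | inj₂ refl = ∈-++⁺ˡ (∈-map⁺ (λ x → ▲ x (Y ∸ suc s)) (∈-upTo⁺ x<))

  top▼-unique : ∀ k → k ≤ Y → Unique (top▼ k)
  top▼-unique zero    _   = []
  top▼-unique (suc s) s<Y =
    ++⁺ (map⁺ (λ e → proj₁ (▼-injective e)) (upTo⁺ (a + s))) (top▼-unique s (≤-trans (n≤1+n s) s<Y)) disjoint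
    where
      disjoint : ∀ {τ} → τ ∈ row▼ s × τ ∈ top▼ s → ⊥
      disjoint (τ∈row , τ∈top) with ∈-map⁻ (λ x → ▼ x (Y ∸ suc s)) τ∈row | top▼⁻ s τ∈top
      ... | _ , _ , refl | _ , s′ , s′<s , _ , e =
        <-irrefl (sym (∸-cancelˡ-≡ s<Y (≤-trans (s≤s (<⇒≤ s′<s)) s<Y) (proj₂ (▼-injective e)))) (s≤s s′<s)

  module _ (i : Fin m) (j : Fin n) (k≤b+t : u i ⊔ v j ≤ b + t) (k≤c+t : u i ⊔ v j ≤ c + t) where

    private
      k : ℕ
      k = u i ⊔ v j
      k≤Y : k ≤ Y
      k≤Y = ≤b+t⇒≤Y k≤b+t

      i< : suc (toℕ i) ≤ m
      i< = Finₚ.toℕ<n i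
      j< : suc (toℕ j) ≤ n
      j< = Finₚ.toℕ<n j

      u≤ : Fin (suc (toℕ i)) → Fin m
      u≤ p = Fin.inject≤ p i<
      v≤ : Fin (suc (toℕ j)) → Fin n
      v≤ p = Fin.inject≤ p j<

    neDents : List Tri
    neDents = map (λ p → neTri a b c t (u (u≤ p))) (allFin (suc (toℕ i)))

    nwDents : List Tri
    nwDents = map (λ p → nwTri a b c t (v (v≤ p))) (allFin (suc (toℕ j)))

    dents : List Tri
    dents = neDents ++ nwDents

    length-dents : length dents ≡ suc (toℕ i) + suc (toℕ j)
    length-dents = trans (length-++ neDents) (cong₂ _+_
      (trans (length-map _ (allFin (suc (toℕ i)))) (length-tabulate {n = suc (toℕ i)} (λ p → p)))
      (trans (length-map _ (allFin (suc (toℕ j)))) (length-tabulate {n = suc (toℕ j)} (λ p → p))))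

    -- Only here is the standing hypothesis (a > 0 or u₁ > 1 or v₁ > 1) needed: otherwise the
    -- first northeast and the first northwest triangle coincide.
    dents-unique : Unique dents
    dents-unique = ++⁺ (map⁺ ne-injective (allFin⁺ _)) (map⁺ nw-injective (allFin⁺ _)) disjoint
      where
        ne-injective : ∀ {p p′} → neTri a b c t (u (u≤ p)) ≡ neTri a b c t (u (u≤ p′)) → p ≡ p′
        ne-injective e = Finₚ.inject≤-injective i< i< _ _ (strictlyIncreasing-injective u u↑ _ _
          (∸-cancelˡ-≡ (≤b+t⇒≤Y (proj₂ (u-range _))) (≤b+t⇒≤Y (proj₂ (u-range _))) (proj₂ (▲-injective e))))
        nw-injective : ∀ {p p′} → nwTri a b c t (v (v≤ p)) ≡ nwTri a b c t (v (v≤ p′)) → p ≡ p′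
        nw-injective e = Finₚ.inject≤-injective j< j< _ _ (strictlyIncreasing-injective v v↑ _ _
          (∸-cancelˡ-≡ (≤c+t⇒≤Y (proj₂ (v-range _))) (≤c+t⇒≤Y (proj₂ (v-range _))) (proj₂ (▲-injective e))))
        disjoint : ∀ {τ} → τ ∈ neDents × τ ∈ nwDents → ⊥
        disjoint (τ∈ne , τ∈nw) with ∈-map⁻ (λ p → neTri a b c t (u (u≤ p))) τ∈ne
                                 | ∈-map⁻ (λ p → nwTri a b c t (v (v≤ p))) τ∈nw
        ... | p , _ , refl | p′ , _ , e with ▲-injective e
        ...   | a+u∸1≡0 , same-row = corner (proj₂ (proj₂ (proj₂ (proj₂ valid))))
          where
            U V : ℕ
            U = u (u≤ p)
            V = v (v≤ p′)
            a+U≡1 : a + U ≡ 1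
            a+U≡1 = trans (sym (m∸n+n≡m (≤-trans (proj₁ (u-range (u≤ p))) (m≤n+m U a)))) (cong (_+ 1) a+u∸1≡0)
            U≡1 : U ≡ 1
            U≡1 = ≤-antisym (≤-trans (m≤n+m U a) (≤-reflexive a+U≡1)) (proj₁ (u-range (u≤ p)))
            a≡0 : a ≡ 0
            a≡0 = +-cancelʳ-≡ 1 a 0 (trans (cong (a +_) (sym U≡1)) a+U≡1)
            V≡1 : V ≡ 1
            V≡1 = trans (sym (∸-cancelˡ-≡ (≤b+t⇒≤Y (proj₂ (u-range _))) (≤c+t⇒≤Y (proj₂ (v-range _))) same-row))
                        U≡1
            corner : 0 < a ⊎ (∀ i → 1 < u i) ⊎ (∀ j → 1 < v j) → ⊥
            corner (inj₁ 0<a)         = <-irrefl (sym a≡0) 0<a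
            corner (inj₂ (inj₁ 1<u)) = <-irrefl (sym U≡1) (1<u (u≤ p))
            corner (inj₂ (inj₂ 1<v)) = <-irrefl (sym V≡1) (1<v (v≤ p′))

    dents-holes : ∀ {e} → e ∈ dents → e ∈ top▲ k × ¬ R e
    dents-holes e∈ with ∈-++⁻ neDents e∈
    ... | inj₁ e∈ne with ∈-map⁻ (λ p → neTri a b c t (u (u≤ p))) e∈ne
    ...   | p , _ , refl = ne∈top (u (u≤ p)) (proj₁ (u-range (u≤ p))) (u≤k p) , λ r → proj₁ (proj₂ r) (u≤ p) refl
      where
        ne∈top : ∀ U → 1 ≤ U → U ≤ k → neTri a b c t U ∈ top▲ k
        ne∈top (suc s) _ s<k = subst (λ x → ▲ (x ∸ 1) (Y ∸ suc s) ∈ top▲ k) (sym (+-suc a s))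
                                 (top▲⁺ k s<k (≤-reflexive (sym (+-suc a s))))
        u≤k : ∀ p → u (u≤ p) ≤ k
        u≤k p = ≤-trans (strictlyIncreasing-monotone u u↑ (u≤ p) i
                  (≤-trans (≤-reflexive (Finₚ.toℕ-inject≤ p i<)) (≤-pred (Finₚ.toℕ<n p)))) (m≤m⊔n (u i) (v j))
    dents-holes e∈ | inj₂ e∈nw with ∈-map⁻ (λ p → nwTri a b c t (v (v≤ p))) e∈nw
    ...   | p , _ , refl = nw∈top (v (v≤ p)) (proj₁ (v-range (v≤ p))) (v≤k p) , λ r → proj₂ (proj₂ r) (v≤ p) refl
      where
        nw∈top : ∀ V → 1 ≤ V → V ≤ k → nwTri a b c t V ∈ top▲ k
        nw∈top (suc s) _ s<k = top▲⁺ k s<k (≤-trans (s≤s z≤n) (≤-reflexive (sym (+-suc a s))))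
        v≤k : ∀ p → v (v≤ p) ≤ k
        v≤k p = ≤-trans (strictlyIncreasing-monotone v v↑ (v≤ p) j
                  (≤-trans (≤-reflexive (Finₚ.toℕ-inject≤ p j<)) (≤-pred (Finₚ.toℕ<n p)))) (m≤n⊔m (u i) (v j))

    top▼⊆R : ∀ {d} → d ∈ top▼ k → R d
    top▼⊆R d∈ with top▼⁻ k d∈
    ... | x , s , s<k , x<a+s , refl = (y+1≤Y , x+1≤a+b+t , b≤x+y+1 , x+y+2≤a+Y) , (λ _ ()) , (λ _ ())
      where
        open ≤-Reasoning
        y : ℕ
        y = Y ∸ suc s
        y+s+1≡Y : y + suc s ≡ Y
        y+s+1≡Y = m∸n+n≡m (≤-trans s<k k≤Y)
        y+1≤Y : y + 1 ≤ b + c + t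
        y+1≤Y = ≤-trans (+-monoʳ-≤ y (s≤s z≤n)) (≤-reflexive y+s+1≡Y)
        x+1≤a+b+t : x + 1 ≤ a + b + t
        x+1≤a+b+t = begin
          x + 1      ≡⟨ +-comm x 1 ⟩
          suc x      ≤⟨ x<a+s ⟩
          a + s      ≤⟨ +-monoʳ-≤ a (≤-trans (n≤1+n s) (≤-trans s<k k≤b+t)) ⟩
          a + (b + t) ≡⟨ +-assoc a b t ⟨
          a + b + t  ∎
        b≤y : b ≤ y
        b≤y = +-cancelʳ-≤ (c + t) b y (begin
          b + (c + t)  ≡⟨ +-assoc b c t ⟨
          Y            ≡⟨ y+s+1≡Y ⟨
          y + suc s    ≤⟨ +-monoʳ-≤ y (≤-trans s<k k≤c+t) ⟩
          y + (c + t)  ∎)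
        b≤x+y+1 : b ≤ x + y + 1
        b≤x+y+1 = ≤-trans b≤y (≤-trans (m≤n+m y x) (m≤m+n (x + y) 1))
        x+y+2≤a+Y : x + y + 2 ≤ a + b + c + t
        x+y+2≤a+Y = begin
          x + y + 2          ≡⟨ shuffle x y ⟩
          suc x + (y + 1)    ≤⟨ +-monoˡ-≤ (y + 1) x<a+s ⟩
          a + s + (y + 1)    ≡⟨ shuffle′ a s y ⟩
          a + (y + suc s)    ≡⟨ cong (a +_) y+s+1≡Y ⟩
          a + Y              ≡⟨ a+Y ⟨
          a + b + c + t      ∎
          where
            shuffle : ∀ x y → x + y + 2 ≡ suc x + (y + 1)
            shuffle = solve-∀
            shuffle′ : ∀ a s y → a + s + (y + 1) ≡ a + (y + suc s)
            shuffle′ = solve-∀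

    top▼-neighbours : ∀ {d σ} → d ∈ top▼ k → R σ → Neighbours d σ → σ ∈ top▲ k
    top▼-neighbours d∈ r nb with top▼⁻ k d∈
    ... | x , s , s<k , x<a+s , refl = above s s<k x<a+s nb r
      where
        above : ∀ s → s < k → x < a + s → ∀ {σ} → Neighbours (▼ x (Y ∸ suc s)) σ → R σ → σ ∈ top▲ k
        above s s<k x< (inj₂ (diag _ _)) _ = top▲⁺ k s<k (≤-trans x< (+-monoʳ-≤ a (n≤1+n s)))
        above s s<k x< (inj₂ (vert _ _)) _ = top▲⁺ k s<k (≤-trans (s≤s x<) (≤-reflexive (sym (+-suc a s))))
        above zero s<k _ (inj₂ (horiz _ _)) r =
          ⊥-elim (1+n≰n (≤-trans (≤-reflexive (trans (+-comm 1 Y) (cong (_+ 1) (+-∸-assoc 1 (≤-trans s<k k≤Y)))))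
                                  (proj₁ (proj₁ r))))
        above (suc s) s<k x< (inj₂ (horiz _ _)) _ =
          subst (λ y → ▲ x y ∈ top▲ k) (+-∸-assoc 1 (≤-trans s<k k≤Y)) (top▲⁺ k (≤-trans (n≤1+n _) s<k) x<)

    criterion-at : suc (toℕ i) + suc (toℕ j) ≤ k
    criterion-at = +-cancelˡ-≤ (length (top▼ k)) _ _ (begin
      length (top▼ k) + (suc (toℕ i) + suc (toℕ j))  ≡⟨ cong (length (top▼ k) +_) length-dents ⟨
      length (top▼ k) + length dents                  ≤⟨ tiling-count T (top▼-unique k k≤Y) dents-unique
                                                            top▼⊆R top▼-neighbours dents-holes ⟩
      length (top▲ k)                                 ≡⟨ length-top▲ k ⟩
      length (top▼ k) + k                             ∎)
      where open ≤-Reasoning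

  indices≤t : ∀ (i : Fin m) (j : Fin n) → suc (toℕ i) + suc (toℕ j) ≤ t
  indices≤t i j = ≤-trans (+-mono-≤ (Finₚ.toℕ<n i) (Finₚ.toℕ<n j)) (≤-reflexive (+-comm m n))

  criterion : Criterion u v
  criterion i j with u i ⊔ v j ≤? b + t | u i ⊔ v j ≤? c + t
  ... | yes k≤b+t | yes k≤c+t = criterion-at i j k≤b+t k≤c+t
  ... | no k≰b+t  | _         = ≤-trans (indices≤t i j) (≤-trans (m≤n+m t b) (<⇒≤ (≰⇒> k≰b+t)))
  ... | _         | no k≰c+t  = ≤-trans (indices≤t i j) (≤-trans (m≤n+m t c) (<⇒≤ (≰⇒> k≰c+t)))

module Sufficiency {a b c m n : ℕ} {u : Fin m → ℕ} {v : Fin n → ℕ}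
  (u↑ : StrictlyIncreasing u) (v↑ : StrictlyIncreasing v)
  (u-range : ∀ i → 1 ≤ u i × u i ≤ b + (n + m)) (v-range : ∀ j → 1 ≤ v j × v j ≤ c + (n + m))
  (criterion : Criterion u v) where

  t : ℕ
  t = n + m
  open Hexagon a b c t
  open Counting Y

  nwAbove : ℕ → ℕ
  nwAbove = count v

  left : ℕ → ℕ
  left y = b ∸ y

  blockEnd : ℕ → ℕ
  blockEnd y = left y + a + nwAbove y

  neX : Fin m → ℕ
  neX i = a + u i ∸ 1

  -- Going down from its dent, the path of the i-th northeast dent keeps its x-coordinate until it
  -- is pushed right by the block and the i paths to its left.
  path : Fin m → ℕ → ℕ
  path i y = neX i ⊔ (blockEnd y + toℕ i)

  NWDentIn : ℕ → Set
  NWDentIn y = Σ (Fin n) λ j → v j + y ≡ Y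

  nwDentIn? : ∀ y → Dec (NWDentIn y)
  nwDentIn? y = Finₚ.any? (λ j → v j + y ≟ Y)

  drop : ℕ → ℕ
  drop y with nwDentIn? y
  ... | yes _ = 1
  ... | no _  = left y ∸ left (suc y)

  nwAbove≤n : ∀ y → nwAbove y ≤ n
  nwAbove≤n = count≤ v

  nwAbove+y≤Y : ∀ y → y ≤ Y → nwAbove y + y ≤ Y
  nwAbove+y≤Y y y≤Y with count≡0⊎last v v↑ y
  ... | inj₁ e rewrite e = y≤Y
  ... | inj₂ (q , e , v+y≤Y) rewrite e =
    ≤-trans (+-monoˡ-≤ y (index<positive v v↑ (proj₁ ∘ v-range) q)) v+y≤Y

  -- The criterion is used only here: it keeps the path of the i-th northeast dent inside the hexagon.
  nwAbove+suc+y≤Y : ∀ i y → u i + y ≤ Y → nwAbove y + suc (toℕ i) + y ≤ Y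
  nwAbove+suc+y≤Y i y u+y≤Y with count≡0⊎last v v↑ y
  ... | inj₁ e rewrite e = ≤-trans (+-monoˡ-≤ y (index<positive u u↑ (proj₁ ∘ u-range) i)) u+y≤Y
  ... | inj₂ (q , e , v+y≤Y) rewrite e = begin
    suc (toℕ q) + suc (toℕ i) + y          ≡⟨ cong (_+ y) (+-comm (suc (toℕ q)) (suc (toℕ i))) ⟩
    suc (toℕ i) + suc (toℕ q) + y          ≤⟨ +-monoˡ-≤ y (criterion i q) ⟩
    (u i ⊔ v q) + y                        ≡⟨ +-distribʳ-⊔ y (u i) (v q) ⟩
    (u i + y) ⊔ (v q + y)                  ≤⟨ ⊔-lub u+y≤Y v+y≤Y ⟩
    Y                                      ∎
    where open ≤-Reasoning

  NWDentIn⇒b≤y : ∀ {y} → NWDentIn y → b ≤ y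
  NWDentIn⇒b≤y {y} (j , v+y≡Y) = +-cancelʳ-≤ (c + t) b y (begin
    b + (c + t)   ≡⟨ +-assoc b c t ⟨
    Y             ≡⟨ v+y≡Y ⟨
    v j + y       ≤⟨ +-monoˡ-≤ y (proj₂ (v-range j)) ⟩
    c + t + y     ≡⟨ +-comm (c + t) y ⟩
    y + (c + t)   ∎)
    where open ≤-Reasoning

  left≡0 : ∀ {y} → b ≤ y → left y ≡ 0
  left≡0 = m≤n⇒m∸n≡0

  left-suc≤left : ∀ y → left (suc y) ≤ left y
  left-suc≤left y = ∸-monoʳ-≤ b (n≤1+n y)

  drop-at-dent : ∀ {y} → NWDentIn y → drop y ≡ 1
  drop-at-dent {y} d with nwDentIn? y
  ... | yes _ = refl
  ... | no ¬d = ⊥-elim (¬d d)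

  drop-off-dent : ∀ {y} → ¬ NWDentIn y → left (suc y) + drop y ≡ left y
  drop-off-dent {y} ¬d with nwDentIn? y
  ... | yes d = ⊥-elim (¬d d)
  ... | no _  = m+[n∸m]≡n (left-suc≤left y)

  drop≤1 : ∀ y → drop y ≤ 1
  drop≤1 y with nwDentIn? y
  ... | yes _ = ≤-refl
  ... | no _  = begin
    left y ∸ left (suc y)                ≤⟨ ∸-monoˡ-≤ (left (suc y)) (left≤1+left-suc b y) ⟩
    suc (left (suc y)) ∸ left (suc y)    ≡⟨ m+n∸n≡m 1 (left (suc y)) ⟩
    1                                    ∎
    where
      open ≤-Reasoning
      left≤1+left-suc : ∀ b y → b ∸ y ≤ suc (b ∸ suc y)
      left≤1+left-suc zero    zero    = z≤n
      left≤1+left-suc zero    (suc _) = z≤n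
      left≤1+left-suc (suc b) zero    = ≤-refl
      left≤1+left-suc (suc b) (suc y) = left≤1+left-suc b y

  drop≡0⊎drop≡1 : ∀ y → drop y ≡ 0 ⊎ drop y ≡ 1
  drop≡0⊎drop≡1 y with drop y | drop≤1 y
  ... | zero  | _       = inj₁ refl
  ... | suc _ | s≤s z≤n = inj₂ refl

  blockEnd-step : ∀ y → blockEnd y ≡ blockEnd (suc y) + drop y
  blockEnd-step y with toSum (nwDentIn? y)
  ... | inj₁ d = begin
    left y + a + nwAbove y                    ≡⟨ cong₂ (λ l w → l + a + w) (left≡0 b≤y) (count-step-hit v v↑ y d) ⟩
    0 + a + suc (nwAbove (suc y))             ≡⟨ shuffle a (nwAbove (suc y)) ⟩
    0 + a + nwAbove (suc y) + 1               ≡⟨ cong₂ (λ l δ → l + a + nwAbove (suc y) + δ)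
                                                   (left≡0 (m≤n⇒m≤1+n b≤y)) (drop-at-dent d) ⟨
    left (suc y) + a + nwAbove (suc y) + drop y ∎
    where
      open ≡-Reasoning
      b≤y = NWDentIn⇒b≤y d
      shuffle : ∀ a w → 0 + a + suc w ≡ 0 + a + w + 1
      shuffle = solve-∀
  ... | inj₂ ¬d = begin
    left y + a + nwAbove y                        ≡⟨ cong₂ (λ l w → l + a + w) (sym (drop-off-dent ¬d))
                                                         (count-step v y λ j e → ¬d (j , e)) ⟩
    left (suc y) + drop y + a + nwAbove (suc y)   ≡⟨ shuffle (left (suc y)) (drop y) a (nwAbove (suc y)) ⟩
    left (suc y) + a + nwAbove (suc y) + drop y   ∎
    where
      open ≡-Reasoning
      shuffle : ∀ l d a w → l + d + a + w ≡ l + a + w + d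
      shuffle = solve-∀

  left-suc+drop≤ : ∀ {y x} → left y ≤ x → (NWDentIn y → 1 ≤ x) → left (suc y) + drop y ≤ x
  left-suc+drop≤ {y} {x} left≤x dent⇒1≤x with toSum (nwDentIn? y)
  ... | inj₁ d  = subst (_≤ x) (sym (cong₂ _+_ (left≡0 (m≤n⇒m≤1+n (NWDentIn⇒b≤y d))) (drop-at-dent d)))
                        (dent⇒1≤x d)
  ... | inj₂ ¬d = subst (_≤ x) (sym (drop-off-dent ¬d)) left≤x

  left≤+drop : ∀ {y x} → left (suc y) ≤ x → left y ≤ x + drop y × (NWDentIn y → 1 ≤ x + drop y)
  left≤+drop {y} {x} left≤x with toSum (nwDentIn? y)
  ... | inj₁ d  = subst (_≤ x + drop y) (sym (left≡0 (NWDentIn⇒b≤y d))) z≤n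
                , λ _ → subst (λ δ → 1 ≤ x + δ) (sym (drop-at-dent d)) (m≤n+m 1 x)
  ... | inj₂ ¬d = subst (_≤ x + drop y) (drop-off-dent ¬d) (+-monoˡ-≤ (drop y) left≤x)
                , λ d → ⊥-elim (¬d d)

  left+y≤b⊔y : ∀ y → left y + y ≤ b ⊔ y
  left+y≤b⊔y y with y ≤? b
  ... | yes y≤b = ≤-trans (≤-reflexive (m∸n+n≡m y≤b)) (m≤m⊔n b y)
  ... | no y≰b  = ≤-trans (≤-reflexive (cong (_+ y) (left≡0 (<⇒≤ (≰⇒> y≰b))))) (m≤n⊔m b y)

  blockEnd+s≤ : ∀ y s → nwAbove y + s ≤ t → blockEnd y + s ≤ a + b + t
  blockEnd+s≤ y s V+s≤t = begin
    left y + a + nwAbove y + s     ≡⟨ +-assoc (left y + a) (nwAbove y) s ⟩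
    left y + a + (nwAbove y + s)   ≤⟨ +-mono-≤ (+-monoˡ-≤ a (m∸n≤m b y)) V+s≤t ⟩
    b + a + t                      ≡⟨ cong (_+ t) (+-comm b a) ⟩
    a + b + t                      ∎
    where open ≤-Reasoning

  blockEnd+s+y≤ : ∀ y s → nwAbove y + s ≤ c + t → nwAbove y + s + y ≤ Y → blockEnd y + s + y ≤ a + b + c + t
  blockEnd+s+y≤ y s V+s≤c+t V+s+y≤Y = begin
    left y + a + nwAbove y + s + y          ≡⟨ shuffle (left y) a (nwAbove y) s y ⟩
    (left y + y) + (a + (nwAbove y + s))    ≤⟨ +-monoˡ-≤ _ (left+y≤b⊔y y) ⟩
    (b ⊔ y) + (a + (nwAbove y + s))         ≡⟨ +-distribʳ-⊔ _ b y ⟩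
    (b + (a + (nwAbove y + s))) ⊔ (y + (a + (nwAbove y + s)))  ≤⟨ ⊔-lub within-right within-top ⟩
    a + b + c + t                           ∎
    where
      open ≤-Reasoning
      shuffle : ∀ l a w s y → l + a + w + s + y ≡ (l + y) + (a + (w + s))
      shuffle = solve-∀
      within-right : b + (a + (nwAbove y + s)) ≤ a + b + c + t
      within-right = ≤-trans (+-monoʳ-≤ b (+-monoʳ-≤ a V+s≤c+t)) (≤-reflexive (shuffle′ a b c t))
        where
          shuffle′ : ∀ a b c t → b + (a + (c + t)) ≡ a + b + c + t
          shuffle′ = solve-∀
      within-top : y + (a + (nwAbove y + s)) ≤ a + b + c + t
      within-top = begin
        y + (a + (nwAbove y + s))    ≡⟨ shuffle″ y a (nwAbove y + s) ⟩
        a + (nwAbove y + s + y)      ≤⟨ +-monoʳ-≤ a V+s+y≤Y ⟩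
        a + Y                        ≡⟨ a+Y ⟨
        a + b + c + t                ∎
        where
          shuffle″ : ∀ y a w → y + (a + w) ≡ a + (w + y)
          shuffle″ = solve-∀

  blockEnd≤a+b+t : ∀ y → blockEnd y ≤ a + b + t
  blockEnd≤a+b+t y = subst (_≤ a + b + t) (+-identityʳ (blockEnd y))
    (blockEnd+s≤ y 0 (subst (_≤ t) (sym (+-identityʳ _)) (≤-trans (nwAbove≤n y) (m≤m+n n m))))

  blockEnd+y≤top : ∀ y → y ≤ Y → blockEnd y + y ≤ a + b + c + t
  blockEnd+y≤top y y≤Y = subst (λ e → e + y ≤ a + b + c + t) (+-identityʳ (blockEnd y))
    (blockEnd+s+y≤ y 0 (subst (_≤ c + t) (sym (+-identityʳ _))
                         (≤-trans (nwAbove≤n y) (≤-trans (m≤m+n n m) (m≤n+m t c))))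
                       (subst (λ w → w + y ≤ Y) (sym (+-identityʳ _)) (nwAbove+y≤Y y y≤Y)))

  neX+1 : ∀ i → neX i + 1 ≡ a + u i
  neX+1 i = m∸n+n≡m (≤-trans (proj₁ (u-range i)) (m≤n+m (u i) a))

  nwAbove+suc≤t : ∀ i y → nwAbove y + suc (toℕ i) ≤ t
  nwAbove+suc≤t i y = +-mono-≤ (nwAbove≤n y) (Finₚ.toℕ<n i)

  blockEnd+suc+y≤ : ∀ i y → u i + y ≤ Y → blockEnd y + suc (toℕ i) + y ≤ a + b + c + t
  blockEnd+suc+y≤ i y u+y≤Y =
    blockEnd+s+y≤ y (suc (toℕ i)) (≤-trans (nwAbove+suc≤t i y) (m≤n+m t c)) (nwAbove+suc+y≤Y i y u+y≤Y)

  blockEnd+i≤path : ∀ i y → blockEnd y + toℕ i ≤ path i y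
  blockEnd+i≤path i y = m≤n⊔m (neX i) (blockEnd y + toℕ i)

  path<a+b+t : ∀ i y → path i y + 1 ≤ a + b + t
  path<a+b+t i y = begin
    path i y + 1                                     ≡⟨ +-comm (path i y) 1 ⟩
    suc (neX i) ⊔ suc (blockEnd y + toℕ i)           ≤⟨ ⊔-lub ne-bound block-bound ⟩
    a + b + t                                        ∎
    where
      open ≤-Reasoning
      ne-bound : suc (neX i) ≤ a + b + t
      ne-bound = begin
        suc (neX i)   ≡⟨ trans (+-comm 1 (neX i)) (neX+1 i) ⟩
        a + u i       ≤⟨ +-monoʳ-≤ a (proj₂ (u-range i)) ⟩
        a + (b + t)   ≡⟨ +-assoc a b t ⟨
        a + b + t     ∎
      block-bound : suc (blockEnd y + toℕ i) ≤ a + b + t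
      block-bound = ≤-trans (≤-reflexive (sym (+-suc (blockEnd y) (toℕ i))))
                            (blockEnd+s≤ y (suc (toℕ i)) (nwAbove+suc≤t i y))

  path+y<top : ∀ i y → u i + y ≤ Y → path i y + y + 1 ≤ a + b + c + t
  path+y<top i y u+y≤Y = begin
    path i y + y + 1                                          ≡⟨ shuffle (path i y) y ⟩
    (suc (neX i) ⊔ suc (blockEnd y + toℕ i)) + y              ≡⟨ +-distribʳ-⊔ y (suc (neX i))
                                                                   (suc (blockEnd y + toℕ i)) ⟩
    (suc (neX i) + y) ⊔ (suc (blockEnd y + toℕ i) + y)        ≤⟨ ⊔-lub ne-bound block-bound ⟩
    a + b + c + t                                             ∎
    where
      open ≤-Reasoning
      shuffle : ∀ p y → p + y + 1 ≡ suc p + y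
      shuffle = solve-∀
      ne-bound : suc (neX i) + y ≤ a + b + c + t
      ne-bound = begin
        suc (neX i) + y     ≡⟨ cong (_+ y) (trans (+-comm 1 (neX i)) (neX+1 i)) ⟩
        a + u i + y         ≡⟨ +-assoc a (u i) y ⟩
        a + (u i + y)       ≤⟨ +-monoʳ-≤ a u+y≤Y ⟩
        a + Y               ≡⟨ a+Y ⟨
        a + b + c + t       ∎
      block-bound : suc (blockEnd y + toℕ i) + y ≤ a + b + c + t
      block-bound = ≤-trans (≤-reflexive (cong (_+ y) (sym (+-suc (blockEnd y) (toℕ i)))))
                            (blockEnd+suc+y≤ i y u+y≤Y)

  path-at-dent : ∀ i y → u i + y ≡ Y → path i y ≡ neX i
  path-at-dent i y u+y≡Y = m≥n⇒m⊔n≡m (+-cancelʳ-≤ y _ _ (≤-pred (begin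
    suc (blockEnd y + toℕ i + y)       ≡⟨ cong (_+ y) (sym (+-suc (blockEnd y) (toℕ i))) ⟩
    blockEnd y + suc (toℕ i) + y       ≤⟨ blockEnd+suc+y≤ i y (≤-reflexive u+y≡Y) ⟩
    a + b + c + t                      ≡⟨ a+Y ⟩
    a + Y                              ≡⟨ cong (a +_) u+y≡Y ⟨
    a + (u i + y)                      ≡⟨ +-assoc a (u i) y ⟨
    a + u i + y                        ≡⟨ cong (_+ y) (neX+1 i) ⟨
    neX i + 1 + y                      ≡⟨ cong (_+ y) (+-comm (neX i) 1) ⟩
    suc (neX i + y)                    ∎)))
    where open ≤-Reasoning

  path-strictlyIncreasing : ∀ i i′ y → toℕ i < toℕ i′ → path i y < path i′ y
  path-strictlyIncreasing i i′ y i<i′ = ⊔-mono-< neX< (+-monoʳ-< (blockEnd y) i<i′)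
    where
      neX< : neX i < neX i′
      neX< = +-cancelʳ-≤ 1 _ _ (begin
        suc (neX i) + 1     ≡⟨ cong suc (neX+1 i) ⟩
        suc (a + u i)       ≤⟨ +-monoʳ-< a (u↑ i i′ i<i′) ⟩
        a + u i′            ≡⟨ neX+1 i′ ⟨
        neX i′ + 1          ∎)
        where open ≤-Reasoning

  path-injective : ∀ i i′ y → path i y ≡ path i′ y → i ≡ i′
  path-injective i i′ y e with <-cmp (toℕ i) (toℕ i′)
  ... | tri< i<i′ _ _ = ⊥-elim (<-irrefl e (path-strictlyIncreasing i i′ y i<i′))
  ... | tri≈ _ i≡i′ _ = Finₚ.toℕ-injective i≡i′
  ... | tri> _ _ i′<i = ⊥-elim (<-irrefl (sym e) (path-strictlyIncreasing i′ i y i′<i))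

  path-step : ∀ i y → path i y ≡ path i (suc y) ⊎ path i y ≡ suc (path i (suc y))
  path-step i y with drop≡0⊎drop≡1 y
  ... | inj₁ drop≡0 = inj₁ (cong (λ e → neX i ⊔ (e + toℕ i)) (trans (blockEnd-step y)
                        (trans (cong (blockEnd (suc y) +_) drop≡0) (+-identityʳ _))))
  ... | inj₂ drop≡1 = subst (λ e → neX i ⊔ (e + toℕ i) ≡ path i (suc y)
                                 ⊎ neX i ⊔ (e + toℕ i) ≡ suc (path i (suc y)))
                        (sym (trans (blockEnd-step y) (trans (cong (blockEnd (suc y) +_) drop≡1) (+-comm _ 1))))
                        (⊔-suc (neX i) (blockEnd (suc y) + toℕ i))
    where
      ⊔-suc : ∀ p q → p ⊔ suc q ≡ p ⊔ q ⊎ p ⊔ suc q ≡ suc (p ⊔ q)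
      ⊔-suc p q with ≤-total p q
      ... | inj₁ p≤q = inj₂ (trans (m≤n⇒m⊔n≡n (m≤n⇒m≤1+n p≤q)) (cong suc (sym (m≤n⇒m⊔n≡n p≤q))))
      ... | inj₂ q≤p with m≤n⇒m<n∨m≡n q≤p
      ...   | inj₁ q<p  = inj₁ (trans (m≥n⇒m⊔n≡m q<p) (sym (m≥n⇒m⊔n≡m q≤p)))
      ...   | inj₂ refl = inj₂ (trans (m≤n⇒m⊔n≡n (n≤1+n p)) (cong suc (sym (⊔-idem p))))

  InBlock : ℕ → ℕ → Set
  InBlock x y = left y ≤ x × x < blockEnd y

  OnPath : ℕ → ℕ → Set
  OnPath x y = Σ (Fin m) λ i → u i + y ≤ Y × path i y ≡ x

  OnPath⇒¬InBlock : ∀ {x y} → OnPath x y → ¬ InBlock x y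
  OnPath⇒¬InBlock {x} {y} (i , _ , path≡x) (_ , x<end) =
    <-irrefl refl (≤-trans x<end (≤-trans (m≤m+n (blockEnd y) (toℕ i))
                                  (≤-trans (blockEnd+i≤path i y) (≤-reflexive path≡x))))

  bottom-row : ∀ x → b ≤ x → x + 1 ≤ a + b + t → InBlock x 0 ⊎ OnPath x 0
  bottom-row x b≤x x<a+b+t with x <? blockEnd 0
  ... | yes x<end = inj₁ (b≤x , x<end)
  ... | no x≮end  = inj₂ (i , u+0≤Y , path≡x)
    where
      open ≤-Reasoning
      end≡ : blockEnd 0 ≡ b + a + n
      end≡ = cong (b + a +_) (count-all v 0 λ j →
               ≤-trans (≤-reflexive (+-identityʳ (v j))) (≤c+t⇒≤Y (proj₂ (v-range j))))
      k : ℕ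
      k = x ∸ blockEnd 0
      end+k≡x : blockEnd 0 + k ≡ x
      end+k≡x = m+[n∸m]≡n (≮⇒≥ x≮end)
      k<m : k < m
      k<m = +-cancelˡ-< (b + a + n) k m (begin-strict
        b + a + n + k     ≡⟨ cong (_+ k) end≡ ⟨
        blockEnd 0 + k    ≡⟨ end+k≡x ⟩
        x                 <⟨ ≤-trans (≤-reflexive (+-comm 1 x)) x<a+b+t ⟩
        a + b + t         ≡⟨ shuffle a b n m ⟩
        b + a + n + m     ∎)
        where
          shuffle : ∀ a b n m → a + b + (n + m) ≡ b + a + n + m
          shuffle = solve-∀
      i : Fin m
      i = Fin.fromℕ< k<m
      i≡k : toℕ i ≡ k
      i≡k = Finₚ.toℕ-fromℕ< k<m
      u+0≤Y : u i + 0 ≤ Y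
      u+0≤Y = ≤-trans (≤-reflexive (+-identityʳ (u i))) (≤b+t⇒≤Y (proj₂ (u-range i)))
      u≤ : u i ≤ b + n + suc k
      u≤ = +-cancelʳ-≤ m _ _ (begin
        u i + m                   ≤⟨ +remaining≤bound u u↑ (b + t) (proj₂ ∘ u-range) i ⟩
        b + t + suc (toℕ i)       ≡⟨ cong (λ z → b + t + suc z) i≡k ⟩
        b + (n + m) + suc k       ≡⟨ shuffle b n m k ⟩
        b + n + suc k + m         ∎)
        where
          shuffle : ∀ b n m k → b + (n + m) + suc k ≡ b + n + suc k + m
          shuffle = solve-∀
      path≡x : path i 0 ≡ x
      path≡x = trans (m≤n⇒m⊔n≡n (+-cancelʳ-≤ 1 _ _ (begin
        neX i + 1                       ≡⟨ neX+1 i ⟩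
        a + u i                         ≤⟨ +-monoʳ-≤ a u≤ ⟩
        a + (b + n + suc k)             ≡⟨ shuffle a b n k ⟩
        b + a + n + k + 1               ≡⟨ cong (λ e → e + k + 1) end≡ ⟨
        blockEnd 0 + k + 1              ≡⟨ cong (λ z → blockEnd 0 + z + 1) i≡k ⟨
        blockEnd 0 + toℕ i + 1          ∎)))
        (trans (cong (blockEnd 0 +_) i≡k) end+k≡x)
        where
          shuffle : ∀ a b n k → a + (b + n + suc k) ≡ b + a + n + k + 1
          shuffle = solve-∀

  InBlock-top : ∀ x → x < a → InBlock x Y
  InBlock-top x x<a = subst (_≤ x) (sym (left≡0 (≤-trans (m≤m+n b c) (m≤m+n (b + c) t)))) z≤n
                    , ≤-trans x<a (≤-trans (m≤n+m a (left Y)) (m≤m+n (left Y + a) (nwAbove Y)))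

  data Kind (x y : ℕ) : Set where
    block    : InBlock x y → Kind x y
    onPath   : ¬ InBlock x y → OnPath x y → Kind x y
    vertical : ¬ InBlock x y → ¬ OnPath x y → Kind x y

  kind : ∀ x y → Kind x y
  kind x y with (left y ≤? x) ×-dec (x <? blockEnd y)
  ... | yes inBlock = block inBlock
  ... | no ¬inBlock with Finₚ.any? (λ i → (u i + y ≤? Y) ×-dec (path i y ≟ x))
  ...   | yes onP = onPath ¬inBlock onP
  ...   | no ¬onP = vertical ¬inBlock ¬onP

  sideDown : ℕ → ℕ → ℕ → Tri
  sideDown x p y with p ≟ x
  ... | yes _ = ▼ x y
  ... | no _  = ▼ (x ∸ 1) y

  sideDown-adjacent : ∀ x p y → p ≡ x ⊎ suc p ≡ x → sideDown x p y ≡ ▼ p y × Adjacent (▲ x y) (sideDown x p y)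
  sideDown-adjacent x p y _ with p ≟ x
  sideDown-adjacent x p y _           | yes refl = refl , diag x y
  sideDown-adjacent x p y (inj₁ p≡x)  | no p≢x   = ⊥-elim (p≢x p≡x)
  sideDown-adjacent x p y (inj₂ refl) | no _     = refl , vert p y

  partnerOf : ∀ x y → Kind x y → Tri
  partnerOf x y (block _)             = sideDown x (x ∸ drop y) y
  partnerOf x y (onPath _ (i , _))    = sideDown x (path i (suc y)) y
  partnerOf x y (vertical _ _)        = ▼ x (y ∸ 1)

  partner : ℕ → ℕ → Tri
  partner x y = partnerOf x y (kind x y)

  upOf : ∀ x y → Kind x (suc y) → Tri
  upOf x y (block _)          = ▲ (x + drop y) y
  upOf x y (onPath _ (i , _)) = ▲ (path i y) y
  upOf x y (vertical _ _)     = ▲ x (suc y)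

  unpartner : Tri → Tri
  unpartner (▼ x y) = upOf x y (kind x (suc y))
  unpartner (▲ x y) = ▲ x y

  partner-block : ∀ {x y} → InBlock x y → partner x y ≡ sideDown x (x ∸ drop y) y
  partner-block {x} {y} inBlock with kind x y
  ... | block _        = refl
  ... | onPath ¬b _    = ⊥-elim (¬b inBlock)
  ... | vertical ¬b _  = ⊥-elim (¬b inBlock)

  partner-path : ∀ {x y} i → u i + y ≤ Y → path i y ≡ x → partner x y ≡ sideDown x (path i (suc y)) y
  partner-path {x} {y} i u+y≤Y path≡x with kind x y
  ... | block inBlock = ⊥-elim (OnPath⇒¬InBlock (i , u+y≤Y , path≡x) inBlock)
  ... | onPath _ (i′ , _ , path′≡x) rewrite path-injective i′ i y (trans path′≡x (sym path≡x)) = refl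
  ... | vertical _ ¬p = ⊥-elim (¬p (i , u+y≤Y , path≡x))

  partner-vertical : ∀ {x y} → ¬ InBlock x y → ¬ OnPath x y → partner x y ≡ ▼ x (y ∸ 1)
  partner-vertical {x} {y} ¬b ¬p with kind x y
  ... | block inBlock = ⊥-elim (¬b inBlock)
  ... | onPath _ onP  = ⊥-elim (¬p onP)
  ... | vertical _ _  = refl

  unpartner-block : ∀ {x y} → InBlock x (suc y) → unpartner (▼ x y) ≡ ▲ (x + drop y) y
  unpartner-block {x} {y} inBlock with kind x (suc y)
  ... | block _       = refl
  ... | onPath ¬b _   = ⊥-elim (¬b inBlock)
  ... | vertical ¬b _ = ⊥-elim (¬b inBlock)

  unpartner-path : ∀ {x y} i → u i + suc y ≤ Y → path i (suc y) ≡ x → unpartner (▼ x y) ≡ ▲ (path i y) y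
  unpartner-path {x} {y} i u+y≤Y path≡x with kind x (suc y)
  ... | block inBlock = ⊥-elim (OnPath⇒¬InBlock (i , u+y≤Y , path≡x) inBlock)
  ... | onPath _ (i′ , _ , path′≡x) rewrite path-injective i′ i (suc y) (trans path′≡x (sym path≡x)) = refl
  ... | vertical _ ¬p = ⊥-elim (¬p (i , u+y≤Y , path≡x))

  unpartner-vertical : ∀ {x y} → ¬ InBlock x (suc y) → ¬ OnPath x (suc y) → unpartner (▼ x y) ≡ ▲ x (suc y)
  unpartner-vertical {x} {y} ¬b ¬p with kind x (suc y)
  ... | block inBlock = ⊥-elim (¬b inBlock)
  ... | onPath _ onP  = ⊥-elim (¬p onP)
  ... | vertical _ _  = refl

  R : Region
  R = Dented a b c t u v

  ne-dent⁺ : ∀ {x y} i → u i + y ≡ Y → x ≡ neX i → ▲ x y ≡ neTri a b c t (u i)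
  ne-dent⁺ {y = y} i u+y≡Y refl = cong (▲ (neX i)) (sym (trans (cong (_∸ u i) (sym u+y≡Y)) (m+n∸m≡n (u i) y)))

  ne-dent⁻ : ∀ {x y} i → ▲ x y ≡ neTri a b c t (u i) → u i + y ≡ Y × x ≡ neX i
  ne-dent⁻ i e with ▲-injective e
  ... | x≡ , refl = m+[n∸m]≡n (≤b+t⇒≤Y (proj₂ (u-range i))) , x≡

  nw-dent⁺ : ∀ {y} j → v j + y ≡ Y → ▲ 0 y ≡ nwTri a b c t (v j)
  nw-dent⁺ {y} j v+y≡Y = cong (▲ 0) (sym (trans (cong (_∸ v j) (sym v+y≡Y)) (m+n∸m≡n (v j) y)))

  nw-dent⁻ : ∀ {x y} j → ▲ x y ≡ nwTri a b c t (v j) → x ≡ 0 × v j + y ≡ Y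
  nw-dent⁻ j e with ▲-injective e
  ... | x≡0 , refl = x≡0 , m+[n∸m]≡n (≤c+t⇒≤Y (proj₂ (v-range j)))

  InHex⇒R▼ : ∀ {x y} → InHex a b c t (▼ x y) → R (▼ x y)
  InHex⇒R▼ hex = hex , (λ _ ()) , (λ _ ())

  Inside : ℕ → ℕ → Set
  Inside p y = b ≤ p + y × p + 1 ≤ a + b + t × p + y + 1 ≤ a + b + c + t

  Inside⇒InHex▲ : ∀ {p y} → Inside p y → y + 1 ≤ Y → InHex a b c t (▲ p y)
  Inside⇒InHex▲ (b≤ , right , top) y<Y = y<Y , right , b≤ , top

  Inside⇒InHex▼ : ∀ {p y} → Inside p (suc y) → y + 1 ≤ Y → InHex a b c t (▼ p y)
  Inside⇒InHex▼ {p} {y} (b≤ , right , top) y<Y =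
    y<Y , right , ≤-trans b≤ (≤-reflexive (shuffle p y)) , ≤-trans (≤-reflexive (shuffle′ p y)) top
    where
      shuffle : ∀ p y → p + suc y ≡ p + y + 1
      shuffle = solve-∀
      shuffle′ : ∀ p y → p + y + 2 ≡ p + suc y + 1
      shuffle′ = solve-∀

  b≤left+y : ∀ y → b ≤ left y + y
  b≤left+y y = ≤-trans (m≤n+m∸n b y) (≤-reflexive (+-comm y (b ∸ y)))

  InBlock⇒Inside : ∀ {p y} → InBlock p y → y ≤ Y → Inside p y
  InBlock⇒Inside {p} {y} (left≤p , p<end) y≤Y =
      ≤-trans (b≤left+y y) (+-monoˡ-≤ y left≤p)
    , ≤-trans (≤-reflexive (+-comm p 1)) (≤-trans p<end (blockEnd≤a+b+t y))
    , ≤-trans (≤-reflexive (+-comm (p + y) 1)) (≤-trans (+-monoˡ-≤ y p<end) (blockEnd+y≤top y y≤Y))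

  OnPath⇒Inside : ∀ {y} i → u i + y ≤ Y → Inside (path i y) y
  OnPath⇒Inside {y} i u+y≤Y =
      ≤-trans (b≤left+y y) (+-monoˡ-≤ y (begin
        left y                      ≤⟨ m≤m+n (left y) (a + nwAbove y) ⟩
        left y + (a + nwAbove y)    ≡⟨ +-assoc (left y) a (nwAbove y) ⟨
        blockEnd y                  ≤⟨ m≤m+n (blockEnd y) (toℕ i) ⟩
        blockEnd y + toℕ i          ≤⟨ blockEnd+i≤path i y ⟩
        path i y                    ∎))
    , path<a+b+t i y
    , path+y<top i y u+y≤Y
    where open ≤-Reasoning

  PartnerSpec : ℕ → ℕ → Set
  PartnerSpec x y = Adjacent (▲ x y) (partner x y) × R (partner x y) × unpartner (partner x y) ≡ ▲ x y

  sideDown-spec : ∀ {x y p} → p ≡ x ⊎ suc p ≡ x → partner x y ≡ sideDown x p y →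
                  R (▼ p y) → unpartner (▼ p y) ≡ ▲ x y → PartnerSpec x y
  sideDown-spec {x} {y} {p} step partner≡ r back with sideDown-adjacent x p y step
  ... | d≡ , adj = subst (λ τ → Adjacent (▲ x y) τ × R τ × unpartner τ ≡ ▲ x y) (sym (trans partner≡ d≡))
                     (subst (Adjacent (▲ x y)) d≡ adj , r , back)

  +drop-step : ∀ p y → p ≡ p + drop y ⊎ suc p ≡ p + drop y
  +drop-step p y with drop≡0⊎drop≡1 y
  ... | inj₁ drop≡0 = inj₁ (trans (sym (+-identityʳ p)) (cong (p +_) (sym drop≡0)))
  ... | inj₂ drop≡1 = inj₂ (trans (+-comm 1 p) (cong (p +_) (sym drop≡1)))

  nw-free⇒1≤x : ∀ {x y} → (∀ j → ¬ ▲ x y ≡ nwTri a b c t (v j)) → NWDentIn y → 1 ≤ x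
  nw-free⇒1≤x {zero}  not-nw (j , v+y≡Y) = ⊥-elim (not-nw j (nw-dent⁺ j v+y≡Y))
  nw-free⇒1≤x {suc _} _      _           = s≤s z≤n

  partner-spec-block : ∀ {x y} → y + 1 ≤ Y → (∀ j → ¬ ▲ x y ≡ nwTri a b c t (v j)) → InBlock x y → PartnerSpec x y
  partner-spec-block {x} {y} y<Y not-nw (left≤x , x<end) =
    sideDown-spec (subst (λ z → p ≡ z ⊎ suc p ≡ z) p+drop≡x (+drop-step p y)) (partner-block (left≤x , x<end))
      (InHex⇒R▼ (Inside⇒InHex▼ (InBlock⇒Inside p-in-block (≤-trans (≤-reflexive (+-comm 1 y)) y<Y)) y<Y))
      (trans (unpartner-block p-in-block) (cong (λ z → ▲ z y) p+drop≡x))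
    where
      p : ℕ
      p = x ∸ drop y
      below≤x : left (suc y) + drop y ≤ x
      below≤x = left-suc+drop≤ left≤x (nw-free⇒1≤x not-nw)
      p+drop≡x : p + drop y ≡ x
      p+drop≡x = m∸n+n≡m (≤-trans (m≤n+m (drop y) (left (suc y))) below≤x)
      p-in-block : InBlock p (suc y)
      p-in-block = +-cancelʳ-≤ (drop y) _ _ (≤-trans below≤x (≤-reflexive (sym p+drop≡x)))
                 , +-cancelʳ-≤ (drop y) _ _ (≤-trans (≤-reflexive (cong suc p+drop≡x))
                                                      (≤-trans x<end (≤-reflexive (blockEnd-step y))))

  partner-spec-path : ∀ {x y} → y + 1 ≤ Y → (∀ i → ¬ ▲ x y ≡ neTri a b c t (u i)) →
                      ∀ i → u i + y ≤ Y → path i y ≡ x → PartnerSpec x y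
  partner-spec-path {x} {y} y<Y not-ne i u+y≤Y path≡x =
    sideDown-spec step (partner-path i u+y≤Y path≡x)
      (InHex⇒R▼ (Inside⇒InHex▼ (OnPath⇒Inside i u+sy≤Y) y<Y))
      (trans (unpartner-path i u+sy≤Y refl) (cong (λ z → ▲ z y) path≡x))
    where
      p : ℕ
      p = path i (suc y)
      step : p ≡ x ⊎ suc p ≡ x
      step with path-step i y
      ... | inj₁ e = inj₁ (trans (sym e) path≡x)
      ... | inj₂ e = inj₂ (trans (sym e) path≡x)
      u+y≢Y : u i + y ≢ Y
      u+y≢Y u+y≡Y = not-ne i (ne-dent⁺ i u+y≡Y (trans (sym path≡x) (path-at-dent i y u+y≡Y)))
      u+sy≤Y : u i + suc y ≤ Y
      u+sy≤Y = ≤-trans (≤-reflexive (+-suc (u i) y)) (≤∧≢⇒< u+y≤Y u+y≢Y)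

  partner-spec-vertical : ∀ {x y} → InHex a b c t (▲ x y) → ¬ InBlock x y → ¬ OnPath x y → PartnerSpec x y
  partner-spec-vertical {x} {zero} (_ , x<a+b+t , b≤x+0 , _) ¬b ¬p
    with bottom-row x (≤-trans b≤x+0 (≤-reflexive (+-identityʳ x))) x<a+b+t
  ... | inj₁ inBlock = ⊥-elim (¬b inBlock)
  ... | inj₂ onP     = ⊥-elim (¬p onP)
  partner-spec-vertical {x} {suc y} (sy<Y , x<a+b+t , b≤ , top) ¬b ¬p
    rewrite partner-vertical ¬b ¬p =
      horiz x y
    , InHex⇒R▼ ( ≤-trans (m≤m+n (y + 1) 1) (≤-trans (≤-reflexive (shuffle y)) sy<Y) , x<a+b+t
               , ≤-trans b≤ (≤-reflexive (shuffle′ x y)) , ≤-trans (≤-reflexive (shuffle″ x y)) top)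
    , unpartner-vertical ¬b ¬p
    where
      shuffle : ∀ y → y + 1 + 1 ≡ suc y + 1
      shuffle = solve-∀
      shuffle′ : ∀ x y → x + suc y ≡ x + y + 1
      shuffle′ = solve-∀
      shuffle″ : ∀ x y → x + y + 2 ≡ x + suc y + 1
      shuffle″ = solve-∀

  partner-spec : ∀ {x y} → R (▲ x y) → Kind x y → PartnerSpec x y
  partner-spec (hex , _ , not-nw) (block inBlock)            = partner-spec-block (proj₁ hex) not-nw inBlock
  partner-spec (hex , not-ne , _) (onPath _ (i , u+y≤Y , e)) = partner-spec-path (proj₁ hex) not-ne i u+y≤Y e
  partner-spec (hex , _ , _)      (vertical ¬b ¬p)           = partner-spec-vertical hex ¬b ¬p

  NWDentIn⇒0<blockEnd : ∀ {y} → NWDentIn y → 0 < blockEnd y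
  NWDentIn⇒0<blockEnd {y} d =
    ≤-trans (subst (1 ≤_) (sym (count-step-hit v v↑ y d)) (s≤s z≤n)) (m≤n+m (nwAbove y) (left y + a))

  Preimage : ℕ → ℕ → Set
  Preimage x y = Σ ℕ λ X → Σ ℕ λ Y′ → R (▲ X Y′) × partner X Y′ ≡ ▼ x y

  preimage-block : ∀ {x y} → InHex a b c t (▼ x y) → InBlock x (suc y) → Preimage x y
  preimage-block {x} {y} hex (left≤x , x<end) =
    X , y , (Inside⇒InHex▲ (InBlock⇒Inside X-in-block y≤Y) (proj₁ hex) , not-ne , not-nw) , partner≡
    where
      X : ℕ
      X = x + drop y
      y≤Y : y ≤ Y
      y≤Y = ≤-trans (m≤m+n y 1) (proj₁ hex)
      bounds : left y ≤ X × (NWDentIn y → 1 ≤ X)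
      bounds = left≤+drop left≤x
      X-in-block : InBlock X y
      X-in-block = proj₁ bounds , ≤-trans (+-monoˡ-≤ (drop y) x<end) (≤-reflexive (sym (blockEnd-step y)))
      not-ne : ∀ i → ¬ ▲ X y ≡ neTri a b c t (u i)
      not-ne i e with ne-dent⁻ i e
      ... | u+y≡Y , X≡neX =
        OnPath⇒¬InBlock (i , ≤-reflexive u+y≡Y , trans (path-at-dent i y u+y≡Y) (sym X≡neX)) X-in-block
      not-nw : ∀ j → ¬ ▲ X y ≡ nwTri a b c t (v j)
      not-nw j e with nw-dent⁻ j e
      ... | X≡0 , v+y≡Y = 1+n≰n (subst (1 ≤_) X≡0 (proj₂ bounds (j , v+y≡Y)))
      partner≡ : partner X y ≡ ▼ x y
      partner≡ = trans (partner-block X-in-block)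
        (trans (cong (λ z → sideDown X z y) (m+n∸n≡m x (drop y))) (proj₁ (sideDown-adjacent X x y (+drop-step x y))))

  preimage-path : ∀ {x y} → InHex a b c t (▼ x y) → ∀ i → u i + suc y ≤ Y → path i (suc y) ≡ x → Preimage x y
  preimage-path {x} {y} hex i u+sy≤Y path≡x =
    X , y , (Inside⇒InHex▲ (OnPath⇒Inside i u+y≤Y) (proj₁ hex) , not-ne , not-nw) , partner≡
    where
      X : ℕ
      X = path i y
      u+y≤Y : u i + y ≤ Y
      u+y≤Y = ≤-trans (+-monoʳ-≤ (u i) (n≤1+n y)) u+sy≤Y
      not-ne : ∀ i′ → ¬ ▲ X y ≡ neTri a b c t (u i′)
      not-ne i′ e with ne-dent⁻ i′ e
      ... | u′+y≡Y , X≡neX′ with path-injective i i′ y (trans X≡neX′ (sym (path-at-dent i′ y u′+y≡Y)))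
      ...   | refl = 1+n≰n (≤-trans (≤-reflexive (sym (+-suc (u i) y))) (≤-trans u+sy≤Y (≤-reflexive (sym u′+y≡Y))))
      not-nw : ∀ j → ¬ ▲ X y ≡ nwTri a b c t (v j)
      not-nw j e with nw-dent⁻ j e
      ... | X≡0 , v+y≡Y = 1+n≰n (subst (1 ≤_) X≡0 (≤-trans (NWDentIn⇒0<blockEnd (j , v+y≡Y))
                              (≤-trans (m≤m+n (blockEnd y) (toℕ i)) (blockEnd+i≤path i y))))
      step : x ≡ X ⊎ suc x ≡ X
      step with path-step i y
      ... | inj₁ e = inj₁ (trans (sym path≡x) (sym e))
      ... | inj₂ e = inj₂ (trans (cong suc (sym path≡x)) (sym e))
      partner≡ : partner X y ≡ ▼ x y
      partner≡ = trans (partner-path i u+y≤Y refl)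
        (trans (cong (λ z → sideDown X z y) path≡x) (proj₁ (sideDown-adjacent X x y step)))

  preimage-vertical : ∀ {x y} → InHex a b c t (▼ x y) → ¬ InBlock x (suc y) → ¬ OnPath x (suc y) → Preimage x y
  preimage-vertical {x} {y} (y<Y , x<a+b+t , b≤ , top) ¬b ¬p =
    x , suc y , (hex , not-ne , not-nw) , partner-vertical ¬b ¬p
    where
      sy≢Y : suc y ≢ Y
      sy≢Y sy≡Y = ¬b (subst (InBlock x) (sym sy≡Y) (InBlock-top x (+-cancelʳ-≤ (suc y) _ _ (begin
        suc x + suc y      ≡⟨ shuffle x y ⟩
        x + y + 2          ≤⟨ top ⟩
        a + b + c + t      ≡⟨ a+Y ⟩
        a + Y              ≡⟨ cong (a +_) sy≡Y ⟨
        a + suc y          ∎))))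
        where
          open ≤-Reasoning
          shuffle : ∀ x y → suc x + suc y ≡ x + y + 2
          shuffle = solve-∀
      hex : InHex a b c t (▲ x (suc y))
      hex = ≤-trans (≤-reflexive (+-comm (suc y) 1)) (≤∧≢⇒< (≤-trans (≤-reflexive (+-comm 1 y)) y<Y) sy≢Y)
          , x<a+b+t , ≤-trans b≤ (≤-reflexive (shuffle x y)) , ≤-trans (≤-reflexive (shuffle′ x y)) top
        where
          shuffle : ∀ x y → x + y + 1 ≡ x + suc y
          shuffle = solve-∀
          shuffle′ : ∀ x y → x + suc y + 1 ≡ x + y + 2
          shuffle′ = solve-∀
      not-ne : ∀ i → ¬ ▲ x (suc y) ≡ neTri a b c t (u i)
      not-ne i e with ne-dent⁻ i e
      ... | u+sy≡Y , x≡neX = ¬p (i , ≤-reflexive u+sy≡Y , trans (path-at-dent i (suc y) u+sy≡Y) (sym x≡neX))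
      not-nw : ∀ j → ¬ ▲ x (suc y) ≡ nwTri a b c t (v j)
      not-nw j e with nw-dent⁻ j e
      ... | refl , v+sy≡Y =
        ¬b (≤-reflexive (left≡0 (NWDentIn⇒b≤y (j , v+sy≡Y))) , NWDentIn⇒0<blockEnd (j , v+sy≡Y))

  preimage : ∀ {x y} → R (▼ x y) → Kind x (suc y) → Preimage x y
  preimage (hex , _) (block inBlock)              = preimage-block hex inBlock
  preimage (hex , _) (onPath _ (i , u+sy≤Y , e))  = preimage-path hex i u+sy≤Y e
  preimage (hex , _) (vertical ¬b ¬p)             = preimage-vertical hex ¬b ¬p

  bounded : ∀ {x y} → R (▲ x y) → x < a + b + c + t × y < a + b + c + t
  bounded {x} {y} ((y<Y , x<a+b+t , _ , _) , _) =
      ≤-trans (≤-reflexive (+-comm 1 x)) (≤-trans x<a+b+t (+-monoˡ-≤ t (m≤m+n (a + b) c)))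
    , ≤-trans (≤-reflexive (+-comm 1 y)) (≤-trans y<Y (≤-trans (m≤n+m Y a) (≤-reflexive (sym a+Y))))

  matching : UpDownMatching R
  matching = record
    { partner            = partner
    ; partner-adjacent   = λ r → proj₁ (partner-spec r (kind _ _))
    ; partner-∈          = λ r → proj₁ (proj₂ (partner-spec r (kind _ _)))
    ; partner-injective  = λ r r′ e → ▲≡⇒pair≡ (trans (sym (back r)) (trans (cong unpartner e) (back r′)))
    ; partner-surjective = λ r → preimage r (kind _ _)
    }
    where
      back : ∀ {x y} → R (▲ x y) → unpartner (partner x y) ≡ ▲ x y
      back r = proj₂ (proj₂ (partner-spec r (kind _ _)))
      ▲≡⇒pair≡ : ∀ {x y x′ y′} → ▲ x y ≡ ▲ x′ y′ → (x , y) ≡ (x′ , y′)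
      ▲≡⇒pair≡ refl = refl

  tiling : Tiling R
  tiling = matching⇒tiling (Dented? a b c t u v) matching (a + b + c + t) bounded

corollary5 : (a b c a′ b′ c′ m n : ℕ)
    (u u′ : Fin m → ℕ) (v v′ : Fin n → ℕ) →
    ValidDents a b c (n + m) u v →
    ValidDents a′ b′ c′ (n + m) u′ v′ →
    (∀ i → u i ≤ u′ i) →
    (∀ j → v j ≤ v′ j) →
    Tileable (Dented a b c (n + m) u v) →
    Tileable (Dented a′ b′ c′ (n + m) u′ v′)
corollary5 a b c a′ b′ c′ m n u u′ v v′ valid (u′↑ , v′↑ , u′-range , v′-range , _) u≤u′ v≤v′ tiled =
  Sufficiency.tiling {a = a′} u′↑ v′↑ u′-range v′-range
    (criterion-mono u≤u′ v≤v′ (Necessity.criterion valid tiled))
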